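{- Let $\mathcal T_1,\mathcal T_2$ be standard tableaux. If $\mathcal T_1'$ occurs in $\mathbb B_2^{(0)}\mathcal T_1$, then $\overset{*}{\mathbb B}{}_2^{(0)}\mathcal T_1'=\mathcal T_1$; if $\mathcal T_2'$ occurs in $\mathbb B_2^{(1)}\mathcal T_2$, then $\overset{*}{\mathbb B}{}_2^{(1)}\mathcal T_2'=\mathcal T_2$.
   Context: Tableaux: a tableau $(\lambda,w)$ is the diagram of $\lambda$ (French convention, rows from the bottom) filled with the letters of the word $w$ left to right, top row first; $w$ is the reading word. Semi-standard: rows weakly increasing, columns strictly increasing upward; standard: semi-standard with letters $1,\dots,n$ each once. $\mathcal T_S$ is the subword of letters in $S$. Transpose $\mathcal T^t$: reflect in the main diagonal. Operators extend linearly to formal sums; products act right to left; word operations act on reading words keeping shape: $\tau_k$ adds $k$ to every letter; $\sigma_i$ ($a=i,b=i+1$), defined when the subword on $\{a,b\}$ has letter counts $(2,1)$ or $(1,2)$, replaces that subword via $aab\leftrightarrow abb$, $aba\leftrightarrow bba$, $baa\leftrightarrow bab$; $r_{(11\to01)}$ replaces the leftmost of exactly two letters $1$ by $0$; $r_{(01\to11)}$, applicable when the subword on $\{0,1\}$ is $01$, replaces the $0$ by $1$; $R_a$ deletes all letters $a$; $A_{n+1,n+1}$ maps a tableau of degree $n$ to the sum of all tableaux obtained by adding a horizontal strip of two cells filled with $n+1$. $\mathbb B_2^{(0)}\mathcal T=\tau_1r_{(11\to01)}\sigma_1\cdots\sigma_nA_{n+1,n+1}\mathcal T$ for standard $\mathcal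 T$ of degree $n$; $\mathbb B_2^{(1)}\mathcal T=(\mathbb B_2^{(0)}\mathcal T^t)^t$. For standard $\mathcal T$ of degree $n$ with $\mathcal T_{\{1,2\}}=12$, $\overset{*}{\mathbb B}{}_2^{(0)}\mathcal T=R_{n-1}\sigma_{n-2}\cdots\sigma_1r_{(01\to11)}\tau_{ -1}\mathcal T$; for $\mathcal T_{\{1,2\}}=21$, $\overset{*}{\mathbb B}{}_2^{(1)}\mathcal T=(\overset{*}{\mathbb B}{}_2^{(0)}\mathcal T^t)^t$. -}

module Defs where

open import Data.Nat using (ℕ; zero; suc; _+_; _∸_; _≤_; _<_; _≥_; _≡ᵇ_)
open import Data.Bool using (Bool; true; false; _∨_; if_then_else_; not)
open import Data.List using (List; []; _∷_; _++_; map; filter; reverse; concat; take; drop; length; upTo; mapMaybe; zip; replicate; applyUpTo)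
open import Data.Nat.ListAction using (sum)
open import Data.List.Relation.Unary.All using (All)
open import Data.List.Relation.Unary.Linked using (Linked)
open import Data.List.Relation.Binary.Permutation.Propositional using (_↭_)
open import Data.Maybe using (Maybe; just; nothing; _>>=_)
open import Data.Product using (Σ; _×_; _,_; ∃; proj₁; proj₂)
open import Relation.Binary.PropositionalEquality using (_≡_)
open import Relation.Nullary.Decidable using (T?)

Word : Set
Word = List ℕ

-- A tableau (λ , w): shape λ listed from the bottom row upward (French
-- convention) and reading word w (rows read left to right, top row first).
record Tableau : Set where
  constructor tab
  field
    shape : List ℕ
    word  : Word
open Tableau public

nth : {A : Set} → ℕ → List A → Maybe A
nth _       []       = nothing
nth zero    (x ∷ xs) = just x
nth (suc i) (x ∷ xs) = nth i xs

part : List ℕ → ℕ → ℕ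
part []       _       = 0
part (x ∷ xs) zero    = x
part (x ∷ xs) (suc i) = part xs i

rowAt : List Word → ℕ → Word
rowAt []       _       = []
rowAt (r ∷ rs) zero    = r
rowAt (r ∷ rs) (suc i) = rowAt rs i

split : List ℕ → Word → List Word
split []       w = []
split (k ∷ ks) w = take k w ∷ split ks (drop k w)

rows : Tableau → List Word
rows t = reverse (split (reverse (shape t)) (word t))

fromRows : List Word → Tableau
fromRows rs = tab (map length rs) (concat (reverse rs))

degree : Tableau → ℕ
degree t = length (word t)

IsPartition : List ℕ → Set
IsPartition λ' = Linked _≥_ λ' × All (λ k → 0 < k) λ'

WellFormed : Tableau → Set
WellFormed t = IsPartition (shape t) × length (word t) ≡ sum (shape t)

ColStrict : Word → Word → Set
ColStrict lower upper = All (λ p → proj₁ p < proj₂ p) (zip lower upper)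

IsSemiStandard : Tableau → Set
IsSemiStandard t =
  WellFormed t
  × All (Linked _≤_) (rows t)
  × All (λ p → ColStrict (proj₁ p) (proj₂ p)) (zip (rows t) (drop 1 (rows t)))

IsStandard : Tableau → Set
IsStandard t = IsSemiStandard t × (word t ↭ map suc (upTo (degree t)))

transposeRows : List Word → List Word
transposeRows rs = applyUpTo (λ j → mapMaybe (nth j) rs) (length (rowAt rs 0))

transpose : Tableau → Tableau
transpose t = fromRows (transposeRows (rows t))

onWord : (Word → Word) → Tableau → Tableau
onWord f t = tab (shape t) (f (word t))

onWordM : (Word → Maybe Word) → Tableau → Maybe Tableau
onWordM f t = f (word t) >>= λ w → just (tab (shape t) w)

τ₊₁ : Word → Word
τ₊₁ = map suc

τ₋₁ : Word → Word
τ₋₁ = map (λ x → x ∸ 1)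

sub : (ℕ → Bool) → Word → Word
sub p = filter (λ x → T? (p x))

count : ℕ → Word → ℕ
count a w = length (sub (λ x → x ≡ᵇ a) w)

replaceSub : (ℕ → Bool) → Word → Word → Word
replaceSub p []       ys       = []
replaceSub p (x ∷ xs) []       = x ∷ xs
replaceSub p (x ∷ xs) (y ∷ ys) with p x
... | true  = y ∷ replaceSub p xs ys
... | false = x ∷ replaceSub p xs (y ∷ ys)

-- the exchange on the subword over {a,b}, coded by false = a, true = b:
-- aab ↔ abb , aba ↔ bba , baa ↔ bab ; undefined otherwise
exch : List Bool → Maybe (List Bool)
exch (false ∷ false ∷ true ∷ [])  = just (false ∷ true ∷ true ∷ [])
exch (false ∷ true ∷ true ∷ [])   = just (false ∷ false ∷ true ∷ [])
exch (false ∷ true ∷ false ∷ [])  = just (true ∷ true ∷ false ∷ [])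
exch (true ∷ true ∷ false ∷ [])   = just (false ∷ true ∷ false ∷ [])
exch (true ∷ false ∷ false ∷ [])  = just (true ∷ false ∷ true ∷ [])
exch (true ∷ false ∷ true ∷ [])   = just (true ∷ false ∷ false ∷ [])
exch _                            = nothing

-- σ_i with a = i, b = i+1 (defined iff the counts on {a,b} are (2,1) or (1,2))
σ : ℕ → Word → Maybe Word
σ i w = exch (map (λ x → x ≡ᵇ suc i) s) >>= λ bs →
          just (replaceSub inAB w (map (λ b → if b then suc i else i) bs))
  where
  inAB : ℕ → Bool
  inAB x = (x ≡ᵇ i) ∨ (x ≡ᵇ suc i)
  s : Word
  s = sub inAB w

-- σ_1 σ_2 ⋯ σ_k (product acting right to left: σ_k is applied first)
σDown : ℕ → Word → Maybe Word
σDown zero    w = just w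
σDown (suc k) w = σ (suc k) w >>= σDown k

-- σ_k ⋯ σ_2 σ_1 (σ_1 is applied first)
σUp : ℕ → Word → Maybe Word
σUp zero    w = just w
σUp (suc k) w = σUp k w >>= σ (suc k)

replaceFirst : ℕ → ℕ → Word → Word
replaceFirst a c []       = []
replaceFirst a c (x ∷ xs) = if x ≡ᵇ a then c ∷ xs else x ∷ replaceFirst a c xs

r11→01 : Word → Maybe Word
r11→01 w = if count 1 w ≡ᵇ 2 then just (replaceFirst 1 0 w) else nothing

is01 : ℕ → Bool
is01 x = (x ≡ᵇ 0) ∨ (x ≡ᵇ 1)

is12 : ℕ → Bool
is12 x = (x ≡ᵇ 1) ∨ (x ≡ᵇ 2)

r01→11 : Word → Maybe Word
r01→11 w with sub is01 w
... | 0 ∷ 1 ∷ [] = just (replaceFirst 0 1 w)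
... | _          = nothing

R : ℕ → Tableau → Tableau
R a t = fromRows (filter (λ r → T? (not (length r ≡ᵇ 0)))
                         (map (filter (λ x → T? (not (x ≡ᵇ a)))) (rows t)))

-- A_{n+1,n+1}: the terms are the tableaux obtained by adding a horizontal
-- strip of two cells filled with n+1 (n = degree)

HStrip2 : List ℕ → List ℕ → Set
HStrip2 λ' μ =
  IsPartition μ
  × (∀ i → part λ' i ≤ part μ i)
  × (∀ i → part μ (suc i) ≤ part λ' i)
  × sum μ ≡ sum λ' + 2

addStrip : Tableau → List ℕ → ℕ → Tableau
addStrip t μ a =
  fromRows (applyUpTo (λ i → rowAt (rows t) i ++ replicate (part μ i ∸ part (shape t) i) a)
                      (length μ))

InA : Tableau → Tableau → Set
InA t S = Σ (List ℕ) λ μ → HStrip2 (shape t) μ × S ≡ addStrip t μ (suc (degree t))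

-- the word part τ₁ r_(11→01) σ_1 ⋯ σ_n applied to a term S of A T (n = deg T)
B0step : ℕ → Tableau → Maybe Tableau
B0step n = onWordM (λ w → σDown n w >>= λ w₁ → r11→01 w₁ >>= λ w₂ → just (τ₊₁ w₂))

OccursB0 : Tableau → Tableau → Set
OccursB0 T T' = Σ Tableau λ S → InA T S × B0step (degree T) S ≡ just T'

-- T' occurs in B_2^(1) T = (B_2^(0) T^t)^t
OccursB1 : Tableau → Tableau → Set
OccursB1 T T' = Σ Tableau λ S → OccursB0 (transpose T) S × T' ≡ transpose S

-- B*_2^(0) T = R_{n-1} σ_{n-2} ⋯ σ_1 r_(01→11) τ_{-1} T, when T_{1,2} = 12
B0* : Tableau → Maybe Tableau
B0* t with sub is12 (word t)
... | 1 ∷ 2 ∷ [] =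
  onWordM (λ w → r01→11 (τ₋₁ w) >>= σUp (degree t ∸ 2)) t >>= λ t₁ →
  just (R (degree t ∸ 1) t₁)
... | _ = nothing

-- B*_2^(1) T = (B*_2^(0) T^t)^t, when T_{1,2} = 21
B1* : Tableau → Maybe Tableau
B1* t with sub is12 (word t)
... | 2 ∷ 1 ∷ [] = B0* (transpose t) >>= λ t₁ → just (transpose t₁)
... | _ = nothing

-- Every step of B₂⁽⁰⁾ is undone by the corresponding step of B*₂⁽⁰⁾: τ₋₁ undoes τ₁, r_(01→11)
-- undoes r_(11→01) (the only 0 is the former first 1), each σᵢ is an involution, and R_{n+1}
-- deletes the added horizontal strip.  For B₂⁽¹⁾ = (B₂⁽⁰⁾ Tᵗ)ᵗ, with Tᵗ again standard and
-- transposition an involution on partition shapes, it remains to see that (B₂⁽⁰⁾ Tᵗ)ᵗ has the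
-- subword 21 on {1,2}.  Along σₙ ⋯ σ₁ the filling stays semistandard while its doubled letter
-- descends from n+1 to 1, so both 1's end up leading the bottom row; after r_(11→01) and τ₁ that
-- row starts with 1 2, whose transpose puts 2 in a higher row than 1, and rows are read top first.

{-# OPTIONS --safe #-}
module Submission where

open import Data.Bool using (Bool; true; false; _∨_; if_then_else_; not; T)
open import Data.Bool.Properties using (∨-zeroʳ)
open import Data.Empty using (⊥; ⊥-elim)
open import Data.List
  using (List; []; _∷_; _++_; map; filter; reverse; concat; take; drop; length; upTo; mapMaybe; zip; replicate; applyUpTo)
import Data.List.Properties as Listₚ
open import Data.List.Relation.Binary.Permutation.Propositional
  using (_↭_; ↭-refl; ↭-sym; ↭-trans; ↭-reflexive; prep; module PermutationReasoning)
import Data.List.Relation.Binary.Permutation.Propositional.Properties as Permₚ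
open import Data.List.Relation.Unary.All as All using (All; []; _∷_)
import Data.List.Relation.Unary.All.Properties as Allₚ
open import Data.List.Relation.Unary.Linked as Linked using (Linked; []; [-]; _∷_)
import Data.List.Relation.Unary.Linked.Properties as Linkedₚ
open import Data.Maybe using (Maybe; just; nothing; _>>=_)
open import Data.Maybe.Properties using (just-injective)
open import Data.Nat using (ℕ; zero; suc; _+_; _∸_; _≤_; _<_; _≥_; _≡ᵇ_; z≤n; s≤s)
open import Data.Nat.ListAction using (sum)
open import Data.Nat.ListAction.Properties using (sum-↭)
import Data.Nat.Properties as ℕₚ
open import Algebra.Properties.CommutativeSemigroup ℕₚ.+-commutativeSemigroup using (interchange)
open import Data.Product using (∃; _×_; _,_; proj₁; proj₂)
open import Data.Sum using (_⊎_; inj₁; inj₂)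
open import Function using (_∘_; _$_)
open import Relation.Binary.PropositionalEquality
  using (_≡_; _≢_; refl; sym; trans; cong; cong₂; subst; subst₂; module ≡-Reasoning)
open import Relation.Nullary using (Dec; yes; no)
open import Relation.Nullary.Decidable using (T?)

open import Defs

>>=-≡just : ∀ {A B : Set} (m : Maybe A) (f : A → Maybe B) {y : B} →
            (m >>= f) ≡ just y → ∃ λ x → m ≡ just x × f x ≡ just y
>>=-≡just (just x) f eq = x , refl , eq

≡ᵇ-refl : ∀ n → (n ≡ᵇ n) ≡ true
≡ᵇ-refl zero    = refl
≡ᵇ-refl (suc n) = ≡ᵇ-refl n

≡ᵇ-true⇒≡ : ∀ {m n} → (m ≡ᵇ n) ≡ true → m ≡ n
≡ᵇ-true⇒≡ {m} {n} e = ℕₚ.≡ᵇ⇒≡ m n (subst T (sym e) _)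

≢⇒≡ᵇ-false : ∀ {m n} → m ≢ n → (m ≡ᵇ n) ≡ false
≢⇒≡ᵇ-false {m} {n} m≢n with m ≡ᵇ n in e
... | true  = ⊥-elim (m≢n (≡ᵇ-true⇒≡ e))
... | false = refl

a≢1+a : ∀ a → a ≢ suc a
a≢1+a a = ℕₚ.<⇒≢ (ℕₚ.n<1+n a)

true-or-false : ∀ b → b ≡ true ⊎ b ≡ false
true-or-false true  = inj₁ refl
true-or-false false = inj₂ refl

module _ (p : ℕ → Bool) where

  sub-accept : ∀ {x} xs → p x ≡ true → sub p (x ∷ xs) ≡ x ∷ sub p xs
  sub-accept xs e rewrite e = refl

  sub-reject : ∀ {x} xs → p x ≡ false → sub p (x ∷ xs) ≡ sub p xs
  sub-reject xs e rewrite e = refl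

  sub-++ : ∀ xs ys → sub p (xs ++ ys) ≡ sub p xs ++ sub p ys
  sub-++ = Listₚ.filter-++ (λ x → T? (p x))

  sub-all : ∀ {xs} → All (λ x → p x ≡ true) xs → sub p xs ≡ xs
  sub-all []       = refl
  sub-all (e ∷ es) = trans (sub-accept _ e) (cong (_ ∷_) (sub-all es))

  sub-none : ∀ {xs} → All (λ x → p x ≡ false) xs → sub p xs ≡ []
  sub-none []       = refl
  sub-none (e ∷ es) = trans (sub-reject _ e) (sub-none es)

  All-sub : ∀ xs → All (λ x → p x ≡ true) (sub p xs)
  All-sub []       = []
  All-sub (x ∷ xs) with p x in e
  ... | true  = e ∷ All-sub xs
  ... | false = All-sub xs

  sub-split : ∀ w X y Y → sub p w ≡ X ++ y ∷ Y →
              ∃ λ A → ∃ λ B → w ≡ A ++ y ∷ B × sub p A ≡ X × sub p B ≡ Y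
  sub-split [] []      y Y ()
  sub-split [] (_ ∷ _) y Y ()
  sub-split (x ∷ w) X y Y eq with p x in e
  ... | false with sub-split w X y Y eq
  ...   | A , B , refl , sA , sB = x ∷ A , B , refl , trans (sub-reject A e) sA , sB
  sub-split (x ∷ w) [] y Y eq | true with refl , sw ← Listₚ.∷-injective eq =
    [] , w , refl , refl , sw
  sub-split (x ∷ w) (_ ∷ X) y Y eq | true
    with refl , sw ← Listₚ.∷-injective eq | sub-split w X y Y (proj₂ (Listₚ.∷-injective eq))
  ... | A , B , refl , sA , sB = x ∷ A , B , refl , trans (sub-accept A e) (cong (x ∷_) sA) , sB

  replaceSub-[] : ∀ xs → replaceSub p xs [] ≡ xs
  replaceSub-[] []      = refl
  replaceSub-[] (_ ∷ _) = refl

  replaceSub-reject : ∀ {x} xs ys → p x ≡ false → replaceSub p (x ∷ xs) ys ≡ x ∷ replaceSub p xs ys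
  replaceSub-reject xs []       e = cong (_ ∷_) (sym (replaceSub-[] xs))
  replaceSub-reject xs (y ∷ ys) e rewrite e = refl

  replaceSub-accept : ∀ {x y} xs ys → p x ≡ true → replaceSub p (x ∷ xs) (y ∷ ys) ≡ y ∷ replaceSub p xs ys
  replaceSub-accept xs ys e rewrite e = refl

  replaceSub-++ : ∀ A rest zs → replaceSub p (A ++ rest) (sub p A ++ zs) ≡ A ++ replaceSub p rest zs
  replaceSub-++ []      rest zs = refl
  replaceSub-++ (x ∷ A) rest zs with true-or-false (p x)
  ... | inj₁ e rewrite sub-accept A e =
    trans (replaceSub-accept (A ++ rest) _ e) (cong (x ∷_) (replaceSub-++ A rest zs))
  ... | inj₂ e rewrite sub-reject A e =
    trans (replaceSub-reject (A ++ rest) _ e) (cong (x ∷_) (replaceSub-++ A rest zs))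

  replaceSub-sub : ∀ xs → replaceSub p xs (sub p xs) ≡ xs
  replaceSub-sub xs = begin
    replaceSub p xs (sub p xs)                ≡⟨ cong₂ (replaceSub p) (Listₚ.++-identityʳ xs) (Listₚ.++-identityʳ (sub p xs)) ⟨
    replaceSub p (xs ++ []) (sub p xs ++ [])  ≡⟨ replaceSub-++ xs [] [] ⟩
    xs ++ []                                  ≡⟨ Listₚ.++-identityʳ xs ⟩
    xs                                        ∎
    where open ≡-Reasoning

  replaceSub-at : ∀ A y B y′ → p y ≡ true →
                  replaceSub p (A ++ y ∷ B) (sub p A ++ y′ ∷ sub p B) ≡ A ++ y′ ∷ B
  replaceSub-at A y B y′ e = begin
    replaceSub p (A ++ y ∷ B) (sub p A ++ y′ ∷ sub p B)  ≡⟨ replaceSub-++ A (y ∷ B) _ ⟩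
    A ++ replaceSub p (y ∷ B) (y′ ∷ sub p B)             ≡⟨ cong (A ++_) (replaceSub-accept B _ e) ⟩
    A ++ y′ ∷ replaceSub p B (sub p B)                   ≡⟨ cong (λ z → A ++ y′ ∷ z) (replaceSub-sub B) ⟩
    A ++ y′ ∷ B                                          ∎
    where open ≡-Reasoning

  length-replaceSub : ∀ w ys → length (replaceSub p w ys) ≡ length w
  length-replaceSub []      ys       = refl
  length-replaceSub (x ∷ w) []       = refl
  length-replaceSub (x ∷ w) (y ∷ ys) with p x
  ... | true  = cong suc (length-replaceSub w ys)
  ... | false = cong suc (length-replaceSub w (y ∷ ys))

  All-replaceSub : ∀ {P : ℕ → Set} w ys → All P w → All P ys → All P (replaceSub p w ys)
  All-replaceSub []      ys       _          _          = []
  All-replaceSub (x ∷ w) []       pw         _          = pw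
  All-replaceSub (x ∷ w) (y ∷ ys) (px ∷ pw) (py ∷ pys) with p x
  ... | true  = py ∷ All-replaceSub w ys pw pys
  ... | false = px ∷ All-replaceSub w (y ∷ ys) pw (py ∷ pys)

  sub-replaceSub : ∀ w ys → length ys ≡ length (sub p w) → All (λ y → p y ≡ true) ys →
                   sub p (replaceSub p w ys) ≡ ys
  sub-replaceSub [] [] _ _ = refl
  sub-replaceSub (x ∷ w) ys l a with true-or-false (p x)
  sub-replaceSub (x ∷ w) [] l a | inj₁ e rewrite sub-accept w e = ⊥-elim (ℕₚ.0≢1+n l)
  sub-replaceSub (x ∷ w) (y ∷ ys) l (py ∷ a) | inj₁ e
    rewrite sub-accept w e | replaceSub-accept {x} {y} w ys e =
    trans (sub-accept _ py) (cong (y ∷_) (sub-replaceSub w ys (ℕₚ.suc-injective l) a))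
  ... | inj₂ e rewrite sub-reject w e | replaceSub-reject w ys e =
    trans (sub-reject _ e) (sub-replaceSub w ys l a)

  replaceSub-replaceSub : ∀ w ys zs → length ys ≡ length (sub p w) → length zs ≡ length (sub p w) →
                          All (λ y → p y ≡ true) ys →
                          replaceSub p (replaceSub p w ys) zs ≡ replaceSub p w zs
  replaceSub-replaceSub []      ys zs _ _ _ = refl
  replaceSub-replaceSub (x ∷ w) ys zs l l′ a with true-or-false (p x)
  replaceSub-replaceSub (x ∷ w) [] zs l l′ a | inj₁ e rewrite sub-accept w e = ⊥-elim (ℕₚ.0≢1+n l)
  replaceSub-replaceSub (x ∷ w) (y ∷ ys) [] l l′ a | inj₁ e rewrite sub-accept w e = ⊥-elim (ℕₚ.0≢1+n l′)
  replaceSub-replaceSub (x ∷ w) (y ∷ ys) (z ∷ zs) l l′ (py ∷ a) | inj₁ e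
    rewrite sub-accept w e | replaceSub-accept {x} {y} w ys e | replaceSub-accept {x} {z} w zs e =
    trans (replaceSub-accept _ zs py)
          (cong (z ∷_) (replaceSub-replaceSub w ys zs (ℕₚ.suc-injective l) (ℕₚ.suc-injective l′) a))
  ... | inj₂ e rewrite sub-reject w e | replaceSub-reject w ys e | replaceSub-reject w zs e =
    trans (replaceSub-reject _ zs e) (cong (x ∷_) (replaceSub-replaceSub w ys zs l l′ a))

sub-++-∷ : ∀ p A {y} B → p y ≡ true → sub p (A ++ y ∷ B) ≡ sub p A ++ y ∷ sub p B
sub-++-∷ p A B e = trans (sub-++ p A _) (cong (sub p A ++_) (sub-accept p B e))

sub-++-replicate : ∀ p {r k c} → All (λ x → p x ≡ true) r → p c ≡ false → sub p (r ++ replicate k c) ≡ r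
sub-++-replicate p {r} {k} {c} keep drop = begin
  sub p (r ++ replicate k c)        ≡⟨ sub-++ p r (replicate k c) ⟩
  sub p r ++ sub p (replicate k c)  ≡⟨ cong₂ _++_ (sub-all p keep) (sub-none p (Allₚ.replicate⁺ k drop)) ⟩
  r ++ []                           ≡⟨ Listₚ.++-identityʳ r ⟩
  r                                 ∎
  where open ≡-Reasoning

count-++ : ∀ k xs ys → count k (xs ++ ys) ≡ count k xs + count k ys
count-++ k xs ys = trans (cong length (sub-++ (_≡ᵇ k) xs ys)) (Listₚ.length-++ (sub (_≡ᵇ k) xs))

count-hit : ∀ k xs → count k (k ∷ xs) ≡ suc (count k xs)
count-hit k xs rewrite ≡ᵇ-refl k = refl

count-miss : ∀ {k x} xs → x ≢ k → count k (x ∷ xs) ≡ count k xs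
count-miss {k} {x} xs x≢k rewrite ≢⇒≡ᵇ-false x≢k = refl

count-none : ∀ {k xs} → All (_≢ k) xs → count k xs ≡ 0
count-none []          = refl
count-none (x≢k ∷ ps) = trans (count-miss _ x≢k) (count-none ps)

count-↭ : ∀ k {xs ys : Word} → xs ↭ ys → count k xs ≡ count k ys
count-↭ k xs↭ys = Permₚ.↭-length (Permₚ.filter-↭ (λ x → T? (x ≡ᵇ k)) xs↭ys)

count-concat : ∀ k (xss : List Word) → count k (concat xss) ≡ sum (map (count k) xss)
count-concat k []         = refl
count-concat k (xs ∷ xss) = trans (count-++ k xs (concat xss)) (cong (count k xs +_) (count-concat k xss))

count-replicate : ∀ k n → count k (replicate n k) ≡ n
count-replicate k zero    = refl
count-replicate k (suc n) = trans (count-hit k (replicate n k)) (cong suc (count-replicate k n))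

count-∷-≤ : ∀ p x xs → count p xs ≤ count p (x ∷ xs)
count-∷-≤ p x xs with x ≡ᵇ p
... | true  = ℕₚ.n≤1+n _
... | false = ℕₚ.≤-refl

count-++-∷ : ∀ k A y B → count k (A ++ y ∷ B) ≡ count k A + count k (y ∷ B)
count-++-∷ k A y B = count-++ k A (y ∷ B)

count-replace-new : ∀ a b A B → b ≢ a → count a (A ++ a ∷ B) ≡ suc (count a (A ++ b ∷ B))
count-replace-new a b A B b≢a = begin
  count a (A ++ a ∷ B)              ≡⟨ count-++-∷ a A a B ⟩
  count a A + count a (a ∷ B)       ≡⟨ cong (count a A +_) (count-hit a B) ⟩
  count a A + suc (count a B)       ≡⟨ ℕₚ.+-suc (count a A) (count a B) ⟩
  suc (count a A + count a B)       ≡⟨ cong (λ n → suc (count a A + n)) (count-miss {a} {b} B b≢a) ⟨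
  suc (count a A + count a (b ∷ B)) ≡⟨ cong suc (count-++-∷ a A b B) ⟨
  suc (count a (A ++ b ∷ B))        ∎
  where open ≡-Reasoning

count-replace-other : ∀ x a b A B → a ≢ x → b ≢ x → count x (A ++ a ∷ B) ≡ count x (A ++ b ∷ B)
count-replace-other x a b A B a≢x b≢x = begin
  count x (A ++ a ∷ B)          ≡⟨ count-++-∷ x A a B ⟩
  count x A + count x (a ∷ B)   ≡⟨ cong (count x A +_) (trans (count-miss {x} {a} B a≢x) (sym (count-miss {x} {b} B b≢x))) ⟩
  count x A + count x (b ∷ B)   ≡⟨ count-++-∷ x A b B ⟨
  count x (A ++ b ∷ B)          ∎
  where open ≡-Reasoning

count-sub : ∀ p {x} w → p x ≡ true → count x (sub p w) ≡ count x w
count-sub p     []      _  = refl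
count-sub p {x} (y ∷ w) px with true-or-false (p y)
... | inj₁ py rewrite sub-accept p {y} w py with y ≡ᵇ x
...   | true  = cong suc (count-sub p w px)
...   | false = count-sub p w px
count-sub p {x} (y ∷ w) px | inj₂ py rewrite sub-reject p {y} w py =
  trans (count-sub p w px) (sym (count-miss w y≢x))
  where
  y≢x : y ≢ x
  y≢x refl with () ← trans (sym px) py

count-++-hit : ∀ k xs ys → suc (count k ys) ≤ count k (xs ++ k ∷ ys)
count-++-hit k xs ys = subst (suc (count k ys) ≤_) (sym (trans (count-++-∷ k xs k ys) (cong (count k xs +_) (count-hit k ys))))
                             (ℕₚ.m≤n+m _ (count k xs))

count-two : ∀ k xs ys zs → 2 ≤ count k (xs ++ k ∷ ys ++ k ∷ zs)
count-two k xs ys zs = ℕₚ.≤-trans (s≤s (ℕₚ.≤-trans (s≤s z≤n) (count-++-hit k ys zs))) (count-++-hit k xs (ys ++ k ∷ zs))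

-- The involutions σᵢ

data ExchView : List Bool → List Bool → Set where
  aab→abb : ExchView (false ∷ false ∷ true ∷ []) (false ∷ true ∷ true ∷ [])
  abb→aab : ExchView (false ∷ true ∷ true ∷ []) (false ∷ false ∷ true ∷ [])
  aba→bba : ExchView (false ∷ true ∷ false ∷ []) (true ∷ true ∷ false ∷ [])
  bba→aba : ExchView (true ∷ true ∷ false ∷ []) (false ∷ true ∷ false ∷ [])
  baa→bab : ExchView (true ∷ false ∷ false ∷ []) (true ∷ false ∷ true ∷ [])
  bab→baa : ExchView (true ∷ false ∷ true ∷ []) (true ∷ false ∷ false ∷ [])

exch-view : ∀ bs {bs′} → exch bs ≡ just bs′ → ExchView bs bs′
exch-view (false ∷ false ∷ true ∷ [])  refl = aab→abb
exch-view (false ∷ true ∷ true ∷ [])   refl = abb→aab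
exch-view (false ∷ true ∷ false ∷ [])  refl = aba→bba
exch-view (true ∷ true ∷ false ∷ [])   refl = bba→aba
exch-view (true ∷ false ∷ false ∷ [])  refl = baa→bab
exch-view (true ∷ false ∷ true ∷ [])   refl = bab→baa
exch-view []                           ()
exch-view (false ∷ [])                 ()
exch-view (true ∷ [])                  ()
exch-view (false ∷ false ∷ [])         ()
exch-view (false ∷ true ∷ [])          ()
exch-view (true ∷ false ∷ [])          ()
exch-view (true ∷ true ∷ [])           ()
exch-view (false ∷ false ∷ false ∷ _)  ()
exch-view (true ∷ true ∷ true ∷ _)     ()
exch-view (false ∷ false ∷ true ∷ _ ∷ _) ()
exch-view (false ∷ true ∷ true ∷ _ ∷ _)  ()
exch-view (false ∷ true ∷ false ∷ _ ∷ _) ()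
exch-view (true ∷ true ∷ false ∷ _ ∷ _)  ()
exch-view (true ∷ false ∷ false ∷ _ ∷ _) ()
exch-view (true ∷ false ∷ true ∷ _ ∷ _)  ()

exch-involutive : ∀ {bs bs′} → ExchView bs bs′ → exch bs′ ≡ just bs
exch-involutive aab→abb = refl
exch-involutive abb→aab = refl
exch-involutive aba→bba = refl
exch-involutive bba→aba = refl
exch-involutive baa→bab = refl
exch-involutive bab→baa = refl

length-exch : ∀ {bs bs′} → ExchView bs bs′ → length bs′ ≡ length bs
length-exch aab→abb = refl
length-exch abb→aab = refl
length-exch aba→bba = refl
length-exch bba→aba = refl
length-exch baa→bab = refl
length-exch bab→baa = refl

inAB : ℕ → ℕ → Bool
inAB i x = (x ≡ᵇ i) ∨ (x ≡ᵇ suc i)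

encode : ℕ → Word → List Bool
encode i = map (λ x → x ≡ᵇ suc i)

decode : ℕ → List Bool → Word
decode i = map (λ b → if b then suc i else i)

n≡ᵇ1+n : ∀ n → (n ≡ᵇ suc n) ≡ false
n≡ᵇ1+n n = ≢⇒≡ᵇ-false (a≢1+a n)

inAB-a : ∀ i → inAB i i ≡ true
inAB-a i rewrite ≡ᵇ-refl i = refl

inAB-b : ∀ i → inAB i (suc i) ≡ true
inAB-b i = trans (cong ((suc i ≡ᵇ i) ∨_) (≡ᵇ-refl i)) (∨-zeroʳ (suc i ≡ᵇ i))

inAB⇒ : ∀ i x → inAB i x ≡ true → x ≡ i ⊎ x ≡ suc i
inAB⇒ i x e with true-or-false (x ≡ᵇ i)
... | inj₁ e₁ = inj₁ (≡ᵇ-true⇒≡ e₁)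
... | inj₂ e₁ rewrite e₁ = inj₂ (≡ᵇ-true⇒≡ e)

encode-decode : ∀ i bs → encode i (decode i bs) ≡ bs
encode-decode i []           = refl
encode-decode i (true ∷ bs)  = cong₂ _∷_ (≡ᵇ-refl i) (encode-decode i bs)
encode-decode i (false ∷ bs) = cong₂ _∷_ (n≡ᵇ1+n i) (encode-decode i bs)

decode-encode : ∀ i {s} → All (λ x → inAB i x ≡ true) s → decode i (encode i s) ≡ s
decode-encode i []                 = refl
decode-encode i {x ∷ _} (px ∷ ps) with inAB⇒ i x px
... | inj₁ refl rewrite n≡ᵇ1+n i = cong (i ∷_) (decode-encode i ps)
... | inj₂ refl rewrite ≡ᵇ-refl i = cong (suc i ∷_) (decode-encode i ps)

All-decode : ∀ {P : ℕ → Set} i bs → P i → P (suc i) → All P (decode i bs)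
All-decode i []           pa pb = []
All-decode i (true ∷ bs)  pa pb = pb ∷ All-decode i bs pa pb
All-decode i (false ∷ bs) pa pb = pa ∷ All-decode i bs pa pb

σ-≡just : ∀ i w {w′} → σ i w ≡ just w′ →
          ∃ λ bs′ → ExchView (encode i (sub (inAB i) w)) bs′ × w′ ≡ replaceSub (inAB i) w (decode i bs′)
σ-≡just i w eq with >>=-≡just (exch (encode i (sub (inAB i) w))) _ eq
... | bs′ , e , refl = bs′ , exch-view _ e , refl

σ-involutive : ∀ i w {w′} → σ i w ≡ just w′ → σ i w′ ≡ just w
σ-involutive i w eq with σ-≡just i w eq
... | bs′ , v , refl = begin
  σ i w′                                          ≡⟨ cong (λ s → exch (encode i s) >>= k) sub-w′ ⟩
  (exch (encode i (decode i bs′)) >>= k)          ≡⟨ cong (λ bs → exch bs >>= k) (encode-decode i bs′) ⟩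
  (exch bs′ >>= k)                                ≡⟨ cong (_>>= k) (exch-involutive v) ⟩
  just (replaceSub p w′ (decode i (encode i s)))  ≡⟨ cong (λ z → just (replaceSub p w′ z)) (decode-encode i (All-sub p w)) ⟩
  just (replaceSub p w′ s)                        ≡⟨ cong just (replaceSub-replaceSub p w _ s len′ refl (All-decode i bs′ (inAB-a i) (inAB-b i))) ⟩
  just (replaceSub p w s)                         ≡⟨ cong just (replaceSub-sub p w) ⟩
  just w                                          ∎
  where
  open ≡-Reasoning
  p = inAB i
  s = sub p w
  w′ = replaceSub p w (decode i bs′)
  k : List Bool → Maybe Word
  k bs = just (replaceSub p w′ (decode i bs))
  len′ : length (decode i bs′) ≡ length s
  len′ = trans (Listₚ.length-map _ bs′) (trans (length-exch v) (Listₚ.length-map _ s))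
  sub-w′ : sub p w′ ≡ decode i bs′
  sub-w′ = sub-replaceSub p w _ len′ (All-decode i bs′ (inAB-a i) (inAB-b i))

σDown⇒σUp : ∀ k w {w₁} → σDown k w ≡ just w₁ → σUp k w₁ ≡ just w
σDown⇒σUp zero    w refl = refl
σDown⇒σUp (suc k) w eq with >>=-≡just (σ (suc k) w) (σDown k) eq
... | w′ , e₁ , e₂ rewrite σDown⇒σUp k w′ e₂ = σ-involutive (suc k) w e₁

All-σ : ∀ {P : ℕ → Set} i w {w′} → P i → P (suc i) → All P w → σ i w ≡ just w′ → All P w′
All-σ i w pa pb pw eq with σ-≡just i w eq
... | bs′ , _ , refl = All-replaceSub (inAB i) w (decode i bs′) pw (All-decode i bs′ pa pb)

length-σ : ∀ i w {w′} → σ i w ≡ just w′ → length w′ ≡ length w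
length-σ i w eq with σ-≡just i w eq
... | bs′ , _ , refl = length-replaceSub (inAB i) w (decode i bs′)

All-σDown : ∀ {P : ℕ → Set} k w {w₁} → (∀ i → P (suc i)) → All P w → σDown k w ≡ just w₁ → All P w₁
All-σDown zero    w h pw refl = pw
All-σDown (suc k) w h pw eq with >>=-≡just (σ (suc k) w) (σDown k) eq
... | w′ , e₁ , e₂ = All-σDown k w′ h (All-σ (suc k) w (h k) (h (suc k)) pw e₁) e₂

length-σDown : ∀ k w {w₁} → σDown k w ≡ just w₁ → length w₁ ≡ length w
length-σDown zero    w refl = refl
length-σDown (suc k) w eq with >>=-≡just (σ (suc k) w) (σDown k) eq
... | w′ , e₁ , e₂ = trans (length-σDown k w′ e₂) (length-σ (suc k) w e₁)

Fills : Tableau → Set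
Fills t = length (word t) ≡ sum (shape t)

split-concat : ∀ (xs : List Word) → split (map length xs) (concat xs) ≡ xs
split-concat []       = refl
split-concat (x ∷ xs) = cong₂ _∷_ (take-++ x) (trans (cong (split (map length xs)) (drop-++ x)) (split-concat xs))
  where
  take-++ : ∀ (x : Word) {r} → take (length x) (x ++ r) ≡ x
  take-++ []      = refl
  take-++ (a ∷ x) = cong (a ∷_) (take-++ x)
  drop-++ : ∀ (x : Word) {r} → drop (length x) (x ++ r) ≡ r
  drop-++ []      = refl
  drop-++ (a ∷ x) = drop-++ x

split-fits : ∀ ks (w : Word) → length w ≡ sum ks → map length (split ks w) ≡ ks × concat (split ks w) ≡ w
split-fits []       []      _ = refl , refl
split-fits (k ∷ ks) w       e with split-fits ks (drop k w) length-rest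
  where
  length-rest : length (drop k w) ≡ sum ks
  length-rest = trans (Listₚ.length-drop k w) (trans (cong (_∸ k) e) (ℕₚ.m+n∸m≡n k (sum ks)))
... | lengths , words = cong₂ _∷_ length-first lengths , trans (cong (take k w ++_) words) (Listₚ.take++drop≡id k w)
  where
  length-first : length (take k w) ≡ k
  length-first = trans (Listₚ.length-take k w) (ℕₚ.m≤n⇒m⊓n≡m (subst (k ≤_) (sym e) (ℕₚ.m≤m+n k (sum ks))))

rows-fromRows : ∀ rs → rows (fromRows rs) ≡ rs
rows-fromRows rs = begin
  reverse (split (reverse (map length rs)) (concat (reverse rs)))  ≡⟨ cong (λ ks → reverse (split ks (concat (reverse rs)))) (Listₚ.reverse-map length rs) ⟨
  reverse (split (map length (reverse rs)) (concat (reverse rs)))  ≡⟨ cong reverse (split-concat (reverse rs)) ⟩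
  reverse (reverse rs)                                             ≡⟨ Listₚ.reverse-involutive rs ⟩
  rs                                                               ∎
  where open ≡-Reasoning

module _ (t : Tableau) (fills : Fills t) where

  private
    fits : map length (split (reverse (shape t)) (word t)) ≡ reverse (shape t)
         × concat (split (reverse (shape t)) (word t)) ≡ word t
    fits = split-fits (reverse (shape t)) (word t) (trans fills (sym (sum-↭ (Permₚ.↭-reverse (shape t)))))

  shape-rows : map length (rows t) ≡ shape t
  shape-rows = trans (Listₚ.reverse-map length (split (reverse (shape t)) (word t)))
                     (trans (cong reverse (proj₁ fits)) (Listₚ.reverse-involutive (shape t)))

  word-rows : concat (reverse (rows t)) ≡ word t
  word-rows = trans (cong concat (Listₚ.reverse-involutive (split (reverse (shape t)) (word t)))) (proj₂ fits)

  fromRows-rows : fromRows (rows t) ≡ t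
  fromRows-rows = cong₂ tab shape-rows word-rows

rows-tab : ∀ {μ w} rs → map length rs ≡ μ → concat (reverse rs) ≡ w → rows (tab μ w) ≡ rs
rows-tab rs refl refl = rows-fromRows rs

length-concat : ∀ (xs : List Word) → length (concat xs) ≡ sum (map length xs)
length-concat []       = refl
length-concat (x ∷ xs) = trans (Listₚ.length-++ x) (cong (length x +_) (length-concat xs))

fromRows-fills : ∀ rs → Fills (fromRows rs)
fromRows-fills rs = begin
  length (concat (reverse rs))  ≡⟨ length-concat (reverse rs) ⟩
  sum (map length (reverse rs)) ≡⟨ cong sum (Listₚ.reverse-map length rs) ⟩
  sum (reverse (map length rs)) ≡⟨ sum-↭ (Permₚ.↭-reverse (map length rs)) ⟩
  sum (map length rs)           ∎
  where open ≡-Reasoning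

All-reverse : ∀ {A : Set} {P : A → Set} {xs} → All P xs → All P (reverse xs)
All-reverse {xs = xs} = Permₚ.All-resp-↭ (↭-sym (Permₚ.↭-reverse xs))

All-rows : ∀ {P : ℕ → Set} t → All P (word t) → All (All P) (rows t)
All-rows t pw = All-reverse (All-split (reverse (shape t)) pw)
  where
  All-split : ∀ {P : ℕ → Set} ks {w} → All P w → All (All P) (split ks w)
  All-split []       pw = []
  All-split (k ∷ ks) pw = Allₚ.take⁺ k pw ∷ All-split ks (Allₚ.drop⁺ k pw)

_⊑_ : List ℕ → List ℕ → Set
λ′ ⊑ μ = ∀ i → part λ′ i ≤ part μ i

length-rowAt : ∀ (rs : List Word) i → length (rowAt rs i) ≡ part (map length rs) i
length-rowAt []       i       = refl
length-rowAt (r ∷ rs) zero    = refl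
length-rowAt (r ∷ rs) (suc i) = length-rowAt rs i

All-rowAt : ∀ {P : Word → Set} {rs : List Word} i → All P rs → P [] → P (rowAt rs i)
All-rowAt i       []         p[] = p[]
All-rowAt zero    (pr ∷ _)   p[] = pr
All-rowAt (suc i) (_ ∷ prs)  p[] = All-rowAt i prs p[]

applyUpTo-cong : ∀ {A : Set} {f g : ℕ → A} L → (∀ i → f i ≡ g i) → applyUpTo f L ≡ applyUpTo g L
applyUpTo-cong zero    f≗g = refl
applyUpTo-cong (suc L) f≗g = cong₂ _∷_ (f≗g 0) (applyUpTo-cong L (λ i → f≗g (suc i)))

applyUpTo-part : ∀ μ → applyUpTo (part μ) (length μ) ≡ μ
applyUpTo-part []      = refl
applyUpTo-part (x ∷ μ) = cong (x ∷_) (applyUpTo-part μ)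

applyUpTo-rowAt : ∀ (X : List Word) {L} → length X ≤ L → applyUpTo (rowAt X) L ≡ X ++ replicate (L ∸ length X) []
applyUpTo-rowAt []      {zero}  _         = refl
applyUpTo-rowAt []      {suc L} _         = cong ([] ∷_) (applyUpTo-rowAt [] z≤n)
applyUpTo-rowAt (x ∷ X) {suc L} (s≤s le) = cong (x ∷_) (applyUpTo-rowAt X le)

length-mono-⊑ : ∀ {λ′} μ → All (0 <_) λ′ → λ′ ⊑ μ → length λ′ ≤ length μ
length-mono-⊑ {λ′} μ pos λ′⊑μ with length λ′ ℕₚ.≤? length μ
... | yes le = le
... | no  gt = ⊥-elim (ℕₚ.<-irrefl refl
                 (ℕₚ.<-≤-trans (part-pos λ′ (ℕₚ.≰⇒> gt) pos) (subst (part λ′ (length μ) ≤_) (part-length μ) (λ′⊑μ (length μ)))))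
  where
  part-length : ∀ μ → part μ (length μ) ≡ 0
  part-length []      = refl
  part-length (_ ∷ μ) = part-length μ
  part-pos : ∀ λ′ {i} → i < length λ′ → All (0 <_) λ′ → 0 < part λ′ i
  part-pos (_ ∷ _)  {zero}  _         (p ∷ _)  = p
  part-pos (_ ∷ λ′) {suc i} (s≤s lt) (_ ∷ ps) = part-pos λ′ lt ps

length-rows-≤ : ∀ T μ → Fills T → All (0 <_) (shape T) → shape T ⊑ μ → length (rows T) ≤ length μ
length-rows-≤ T μ fills pos T⊑μ =
  subst (_≤ length μ) (trans (cong length (sym (shape-rows T fills))) (Listₚ.length-map length (rows T))) (length-mono-⊑ μ pos T⊑μ)

nonempty? : (r : Word) → Dec (T (not (length r ≡ᵇ 0)))
nonempty? r = T? (not (length r ≡ᵇ 0))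

filter-nonempty-++-empty : ∀ {X : List Word} {k} → All (λ r → 0 < length r) X → filter nonempty? (X ++ replicate k []) ≡ X
filter-nonempty-++-empty {[]}          {zero}  []       = refl
filter-nonempty-++-empty {[]}          {suc k} []       = filter-nonempty-++-empty {[]} {k} []
filter-nonempty-++-empty {(a ∷ r) ∷ X}         (_ ∷ ps) = cong ((a ∷ r) ∷_) (filter-nonempty-++-empty ps)

stripRow : Tableau → List ℕ → ℕ → ℕ → Word
stripRow T μ c i = rowAt (rows T) i ++ replicate (part μ i ∸ part (shape T) i) c

module _ (T : Tableau) (fills : Fills T) (μ : List ℕ) (T⊑μ : shape T ⊑ μ) where

  length-stripRow : ∀ c i → length (stripRow T μ c i) ≡ part μ i
  length-stripRow c i = begin
    length (stripRow T μ c i)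
      ≡⟨ Listₚ.length-++ (rowAt (rows T) i) ⟩
    length (rowAt (rows T) i) + length (replicate (part μ i ∸ part (shape T) i) c)
      ≡⟨ cong₂ _+_ (trans (length-rowAt (rows T) i) (cong (λ s → part s i) (shape-rows T fills)))
                   (Listₚ.length-replicate (part μ i ∸ part (shape T) i)) ⟩
    part (shape T) i + (part μ i ∸ part (shape T) i)
      ≡⟨ ℕₚ.m+[n∸m]≡n (T⊑μ i) ⟩
    part μ i ∎
    where open ≡-Reasoning

  shape-stripRows : ∀ c → map length (applyUpTo (stripRow T μ c) (length μ)) ≡ μ
  shape-stripRows c = trans (Listₚ.map-applyUpTo (stripRow T μ c) length (length μ))
                            (trans (applyUpTo-cong (length μ) (length-stripRow c)) (applyUpTo-part μ))

  length-addStrip : ∀ c → sum μ ≡ sum (shape T) + 2 → length (word (addStrip T μ c)) ≡ 2 + degree T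
  length-addStrip c sumμ = begin
    length (word (addStrip T μ c))                            ≡⟨ fromRows-fills (applyUpTo (stripRow T μ c) (length μ)) ⟩
    sum (map length (applyUpTo (stripRow T μ c) (length μ)))  ≡⟨ cong sum (shape-stripRows c) ⟩
    sum μ                                                     ≡⟨ sumμ ⟩
    sum (shape T) + 2                                         ≡⟨ cong (_+ 2) fills ⟨
    degree T + 2                                              ≡⟨ ℕₚ.+-comm (degree T) 2 ⟩
    2 + degree T                                              ∎
    where open ≡-Reasoning

  R-addStrip : ∀ {n} → All (0 <_) (shape T) → All (_≤ n) (word T) → R (suc n) (addStrip T μ (suc n)) ≡ T
  R-addStrip {n} pos bounded = begin
    fromRows (filter nonempty? (map (sub (keep c)) (rows (fromRows rs))))
      ≡⟨ cong (λ z → fromRows (filter nonempty? (map (sub (keep c)) z))) (rows-fromRows rs) ⟩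
    fromRows (filter nonempty? (map (sub (keep c)) rs))
      ≡⟨ cong (λ z → fromRows (filter nonempty? z)) (Listₚ.map-applyUpTo (stripRow T μ c) (sub (keep c)) (length μ)) ⟩
    fromRows (filter nonempty? (applyUpTo (λ i → sub (keep c) (stripRow T μ c i)) (length μ)))
      ≡⟨ cong (λ z → fromRows (filter nonempty? z)) (applyUpTo-cong (length μ) strip-removed) ⟩
    fromRows (filter nonempty? (applyUpTo (rowAt X) (length μ)))
      ≡⟨ cong (λ z → fromRows (filter nonempty? z)) (applyUpTo-rowAt X (length-rows-≤ T μ fills pos T⊑μ)) ⟩
    fromRows (filter nonempty? (X ++ replicate (length μ ∸ length X) []))
      ≡⟨ cong fromRows (filter-nonempty-++-empty (Allₚ.map⁻ (subst (All (0 <_)) (sym (shape-rows T fills)) pos))) ⟩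
    fromRows X
      ≡⟨ fromRows-rows T fills ⟩
    T ∎
    where
    open ≡-Reasoning
    c = suc n
    X = rows T
    rs = applyUpTo (stripRow T μ c) (length μ)
    keep : ℕ → ℕ → Bool
    keep a x = not (x ≡ᵇ a)
    keep-old : ∀ {x} → x ≤ n → keep c x ≡ true
    keep-old {x} x≤n rewrite ≢⇒≡ᵇ-false {x} {c} (λ x≡c → ℕₚ.<-irrefl x≡c (s≤s x≤n)) = refl
    keep-new : keep c c ≡ false
    keep-new rewrite ≡ᵇ-refl c = refl
    strip-removed : ∀ i → sub (keep c) (stripRow T μ c i) ≡ rowAt X i
    strip-removed i = sub-++-replicate (keep c) (All.map keep-old (All-rowAt i (All-rows T bounded) [])) keep-new

All-addStrip : ∀ {P : ℕ → Set} T μ c → All P (word T) → P c → All P (word (addStrip T μ c))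
All-addStrip T μ c pw pc =
  Allₚ.concat⁺ (All-reverse (Allₚ.applyUpTo⁺₂ (stripRow T μ c) (length μ)
    (λ i → Allₚ.++⁺ (All-rowAt i (All-rows T pw) []) (Allₚ.replicate⁺ _ pc))))

-- B*₂⁽⁰⁾ inverts B₂⁽⁰⁾

A-term : Tableau → List ℕ → Tableau
A-term T μ = addStrip T μ (suc (degree T))

record B0Occurrence (T T′ : Tableau) : Set where
  field
    μ       : List ℕ
    w₁      : Word
    strip   : HStrip2 (shape T) μ
    sorting : σDown (degree T) (word (A-term T μ)) ≡ just w₁
    ones    : count 1 w₁ ≡ 2
    result  : T′ ≡ tab (shape (A-term T μ)) (map suc (replaceFirst 1 0 w₁))

OccursB0⇒B0Occurrence : ∀ {T T′} → OccursB0 T T′ → B0Occurrence T T′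
OccursB0⇒B0Occurrence {T} (S , (μ , strip , refl) , eq)
  with >>=-≡just (σDown (degree T) (word S) >>= λ w₁ → r11→01 w₁ >>= λ w₂ → just (τ₊₁ w₂)) _ eq
... | _ , e , refl with >>=-≡just (σDown (degree T) (word S)) _ e
... | w₁ , sorting , e′ with >>=-≡just (r11→01 w₁) _ e′
... | _ , r , refl with count 1 w₁ ≡ᵇ 2 in ones
... | true with refl ← r = record
  { μ = μ ; w₁ = w₁ ; strip = strip ; sorting = sorting ; ones = ≡ᵇ-true⇒≡ ones ; result = refl }

Positive : Word → Set
Positive = All (1 ≤_)

sub-is12-τ₊₁ : ∀ w → sub is12 (τ₊₁ w) ≡ map suc (sub is01 w)
sub-is12-τ₊₁ []                 = refl
sub-is12-τ₊₁ (zero ∷ w)         = cong (1 ∷_) (sub-is12-τ₊₁ w)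
sub-is12-τ₊₁ (suc zero ∷ w)     = cong (2 ∷_) (sub-is12-τ₊₁ w)
sub-is12-τ₊₁ (suc (suc _) ∷ w)  = sub-is12-τ₊₁ w

τ₋₁-τ₊₁ : ∀ w → τ₋₁ (τ₊₁ w) ≡ w
τ₋₁-τ₊₁ []      = refl
τ₋₁-τ₊₁ (x ∷ w) = cong (x ∷_) (τ₋₁-τ₊₁ w)

sub-is01-positive : ∀ {w} → Positive w → sub is01 w ≡ replicate (count 1 w) 1
sub-is01-positive {[]}              []      = refl
sub-is01-positive {suc zero ∷ _}    (_ ∷ p) = cong (1 ∷_) (sub-is01-positive p)
sub-is01-positive {suc (suc _) ∷ _} (_ ∷ p) = sub-is01-positive p

sub-is01-replaceFirst : ∀ {w} → Positive w → sub is01 w ≡ 1 ∷ 1 ∷ [] → sub is01 (replaceFirst 1 0 w) ≡ 0 ∷ 1 ∷ []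
sub-is01-replaceFirst {suc zero ∷ w}    (_ ∷ p) e = cong (0 ∷_) (Listₚ.∷-injectiveʳ e)
sub-is01-replaceFirst {suc (suc _) ∷ w} (_ ∷ p) e = sub-is01-replaceFirst p e

replaceFirst-replaceFirst : ∀ {w} → Positive w → replaceFirst 0 1 (replaceFirst 1 0 w) ≡ w
replaceFirst-replaceFirst {[]}                  []      = refl
replaceFirst-replaceFirst {suc zero ∷ w}        (_ ∷ p) = refl
replaceFirst-replaceFirst {suc (suc x) ∷ w}     (_ ∷ p) = cong (suc (suc x) ∷_) (replaceFirst-replaceFirst p)

length-replaceFirst : ∀ a c w → length (replaceFirst a c w) ≡ length w
length-replaceFirst a c []      = refl
length-replaceFirst a c (x ∷ w) with x ≡ᵇ a
... | true  = refl
... | false = cong suc (length-replaceFirst a c w)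

r01→11-01 : ∀ w → sub is01 w ≡ 0 ∷ 1 ∷ [] → r01→11 w ≡ just (replaceFirst 0 1 w)
r01→11-01 w e rewrite e = refl

B0*-unfold : ∀ t → sub is12 (word t) ≡ 1 ∷ 2 ∷ [] →
         B0* t ≡ (onWordM (λ w → r01→11 (τ₋₁ w) >>= σUp (degree t ∸ 2)) t >>= λ t₁ → just (R (degree t ∸ 1) t₁))
B0*-unfold t e rewrite e = refl

B1*-unfold : ∀ t → sub is12 (word t) ≡ 2 ∷ 1 ∷ [] → B1* t ≡ (B0* (transpose t) >>= λ t₁ → just (transpose t₁))
B1*-unfold t e rewrite e = refl

InRange : ℕ → Word → Set
InRange n = All (λ x → 1 ≤ x × x ≤ n)

B0*-B0 : ∀ {T T′} → WellFormed T → InRange (degree T) (word T) → OccursB0 T T′ → B0* T′ ≡ just T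
B0*-B0 {T} ((_ , pos) , fills) range occ rewrite B0Occurrence.result (OccursB0⇒B0Occurrence {T} occ) = B0*-τ₊₁w₂
  where
  open B0Occurrence (OccursB0⇒B0Occurrence {T} occ) hiding (result)
  n = degree T
  S = A-term T μ
  w₂ = replaceFirst 1 0 w₁
  positive : Positive w₁
  positive = All-σDown n (word S) (λ _ → s≤s z≤n) (All-addStrip T μ (suc n) (All.map proj₁ range) (s≤s z≤n)) sorting
  is01-01 : sub is01 w₂ ≡ 0 ∷ 1 ∷ []
  is01-01 = sub-is01-replaceFirst positive (trans (sub-is01-positive positive) (cong (λ k → replicate k 1) ones))
  is12-12 : sub is12 (τ₊₁ w₂) ≡ 1 ∷ 2 ∷ []
  is12-12 = trans (sub-is12-τ₊₁ w₂) (cong (map suc) is01-01)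
  length-B0 : length (τ₊₁ w₂) ≡ 2 + n
  length-B0 = trans (Listₚ.length-map suc w₂) (trans (length-replaceFirst 1 0 w₁)
                (trans (length-σDown n (word S) sorting) (length-addStrip T fills μ (proj₁ (proj₂ strip)) (suc n) (proj₂ (proj₂ (proj₂ strip))))))
  B0*-τ₊₁w₂ : B0* (tab (shape S) (τ₊₁ w₂)) ≡ just T
  B0*-τ₊₁w₂ rewrite B0*-unfold (tab (shape S) (τ₊₁ w₂)) is12-12 | length-B0 | τ₋₁-τ₊₁ w₂
                 | r01→11-01 w₂ is01-01 | replaceFirst-replaceFirst positive | σDown⇒σUp n (word S) sorting
    = cong just (R-addStrip T fills μ (proj₁ (proj₂ strip)) pos (All.map proj₂ range))

-- Transposition

Sorted : Word → Set
Sorted = Linked _≤_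

column : ℕ → List Word → Word
column j = mapMaybe (nth j)

Decreasing : List Word → Set
Decreasing X = Linked _≥_ (map length X)

PartitionRows : List Word → Set
PartitionRows X = Decreasing X × All (λ r → 0 < length r) X

Decreasing-head : ∀ r X → Decreasing (r ∷ X) → All (λ r′ → length r′ ≤ length r) X
Decreasing-head r []      _         = []
Decreasing-head r (_ ∷ _) (le ∷ d) = Allₚ.map⁻ (Linkedₚ.Linked⇒All (λ x≥y y≥z → ℕₚ.≤-trans y≥z x≥y) le d)

nth-≥ : ∀ {A : Set} (r : List A) {j} → length r ≤ j → nth j r ≡ nothing
nth-≥ []      _         = refl
nth-≥ (x ∷ r) (s≤s le) = nth-≥ r le

nth≡nothing⇒≥ : ∀ {A : Set} (r : List A) j → nth j r ≡ nothing → length r ≤ j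
nth≡nothing⇒≥ []      j       _  = z≤n
nth≡nothing⇒≥ (x ∷ r) (suc j) e = s≤s (nth≡nothing⇒≥ r j e)

nth-< : ∀ {A : Set} (r : List A) {j} → j < length r → ∃ λ v → nth j r ≡ just v
nth-< (x ∷ r) {zero}  _         = x , refl
nth-< (x ∷ r) {suc j} (s≤s lt) = nth-< r lt

nth-ext : ∀ {A : Set} (u v : List A) → (∀ i → nth i u ≡ nth i v) → u ≡ v
nth-ext []      []      _ = refl
nth-ext []      (_ ∷ _) h with () ← h 0
nth-ext (_ ∷ _) []      h with () ← h 0
nth-ext (x ∷ u) (y ∷ v) h = cong₂ _∷_ (just-injective (h 0)) (nth-ext u v (λ i → h (suc i)))

rowAt-ext : ∀ (X Y : List Word) → length X ≡ length Y → (∀ i → rowAt X i ≡ rowAt Y i) → X ≡ Y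
rowAt-ext []      []      _ _ = refl
rowAt-ext (x ∷ X) (y ∷ Y) l h = cong₂ _∷_ (h 0) (rowAt-ext X Y (ℕₚ.suc-injective l) (λ i → h (suc i)))

rowAt-short : ∀ {j} (X : List Word) i → All (λ r → length r ≤ j) X → length (rowAt X i) ≤ j
rowAt-short []      i       _          = z≤n
rowAt-short (r ∷ X) zero    (le ∷ _)   = le
rowAt-short (r ∷ X) (suc i) (_ ∷ les) = rowAt-short X i les

column-short : ∀ {j} (X : List Word) → All (λ r → length r ≤ j) X → column j X ≡ []
column-short []      []          = refl
column-short (r ∷ X) (le ∷ les) rewrite nth-≥ r le = column-short X les

Decreasing-short : ∀ r X {j} → Decreasing (r ∷ X) → length r ≤ j → All (λ r′ → length r′ ≤ j) X
Decreasing-short r X d le = All.map (λ le′ → ℕₚ.≤-trans le′ le) (Decreasing-head r X d)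

nth-column : ∀ (X : List Word) i j → Decreasing X → nth i (column j X) ≡ nth j (rowAt X i)
nth-column []      i       j _ = refl
nth-column (r ∷ X) i       j d with nth j r in e
nth-column (r ∷ X) zero    j d | just v  = sym e
nth-column (r ∷ X) (suc i) j d | just v  = nth-column X i j (Linked.tail d)
nth-column (r ∷ X) zero    j d | nothing
  rewrite column-short X (Decreasing-short r X d (nth≡nothing⇒≥ r j e)) = sym e
nth-column (r ∷ X) (suc i) j d | nothing
  rewrite column-short X (Decreasing-short r X d (nth≡nothing⇒≥ r j e)) =
  sym (nth-≥ (rowAt X i) (rowAt-short X i (Decreasing-short r X d (nth≡nothing⇒≥ r j e))))

rowAt-applyUpTo-< : ∀ (g : ℕ → Word) {L j} → j < L → rowAt (applyUpTo g L) j ≡ g j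
rowAt-applyUpTo-< g {suc L} {zero}  _         = refl
rowAt-applyUpTo-< g {suc L} {suc j} (s≤s lt) = rowAt-applyUpTo-< (λ i → g (suc i)) lt

rowAt-applyUpTo-≥ : ∀ (g : ℕ → Word) {L j} → L ≤ j → rowAt (applyUpTo g L) j ≡ []
rowAt-applyUpTo-≥ g {zero}              _         = refl
rowAt-applyUpTo-≥ g {suc L} {suc j} (s≤s le) = rowAt-applyUpTo-≥ (λ i → g (suc i)) le

rowAt-transposeRows : ∀ (X : List Word) j → Decreasing X → rowAt (transposeRows X) j ≡ column j X
rowAt-transposeRows []      j d = rowAt-applyUpTo-≥ (λ j → column j []) {0} {j} z≤n
rowAt-transposeRows (r ∷ X) j d with j ℕₚ.<? length r
... | yes lt = rowAt-applyUpTo-< (λ j → column j (r ∷ X)) lt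
... | no  ge = trans (rowAt-applyUpTo-≥ (λ j → column j (r ∷ X)) (ℕₚ.≮⇒≥ ge))
                     (sym (column-short (r ∷ X) (ℕₚ.≮⇒≥ ge ∷ Decreasing-short r X d (ℕₚ.≮⇒≥ ge))))

length-column-suc : ∀ (X : List Word) j → length (column (suc j) X) ≤ length (column j X)
length-column-suc []      j = z≤n
length-column-suc (r ∷ X) j with nth (suc j) r in e₁ | nth j r in e₀
... | just _  | just _  = s≤s (length-column-suc X j)
... | nothing | just _  = ℕₚ.m≤n⇒m≤1+n (length-column-suc X j)
... | nothing | nothing = length-column-suc X j
... | just _  | nothing with () ← trans (sym e₁) (nth-≥ r (ℕₚ.m≤n⇒m≤1+n (nth≡nothing⇒≥ r j e₀)))

transposeRows-decreasing : ∀ X → Decreasing (transposeRows X)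
transposeRows-decreasing X =
  subst (Linked _≥_) (sym (Listₚ.map-applyUpTo (λ j → column j X) length (length (rowAt X 0))))
        (Linkedₚ.applyUpTo⁺₂ (λ j → length (column j X)) (length (rowAt X 0)) (length-column-suc X))

transposeRows-nonempty : ∀ X → All (λ c → 0 < length c) (transposeRows X)
transposeRows-nonempty []      = []
transposeRows-nonempty (r ∷ X) = Allₚ.applyUpTo⁺₁ (λ j → column j (r ∷ X)) (length r) nonempty
  where
  nonempty : ∀ {j} → j < length r → 0 < length (column j (r ∷ X))
  nonempty {j} lt with nth j r | nth-< r lt
  ... | just _ | _ = s≤s z≤n

transposeRows-involutive : ∀ X → PartitionRows X → transposeRows (transposeRows X) ≡ X
transposeRows-involutive X (d , nonempty) = rowAt-ext (transposeRows Y) X same-length same-rows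
  where
  Y = transposeRows X
  length-column-0 : ∀ X → All (λ r → 0 < length r) X → length (column 0 X) ≡ length X
  length-column-0 []            []       = refl
  length-column-0 ((_ ∷ _) ∷ X) (_ ∷ ps) = cong suc (length-column-0 X ps)
  same-length : length (transposeRows Y) ≡ length X
  same-length = trans (Listₚ.length-applyUpTo _ (length (rowAt Y 0)))
                      (trans (cong length (rowAt-transposeRows X 0 d)) (length-column-0 X nonempty))
  same-rows : ∀ i → rowAt (transposeRows Y) i ≡ rowAt X i
  same-rows i = trans (rowAt-transposeRows Y i (transposeRows-decreasing X)) (nth-ext _ _ λ j → begin
    nth j (column i Y)           ≡⟨ nth-column Y j i (transposeRows-decreasing X) ⟩
    nth i (rowAt Y j)            ≡⟨ cong (nth i) (rowAt-transposeRows X j d) ⟩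
    nth i (column j X)           ≡⟨ nth-column X i j d ⟩
    nth j (rowAt X i)            ∎)
    where open ≡-Reasoning

peel : List Word → List Word
peel X = filter nonempty? (map (drop 1) X)

column-peel : ∀ (X : List Word) j → column (suc j) X ≡ column j (peel X)
column-peel X j = trans (column-drop X) (column-filter (map (drop 1) X))
  where
  column-drop : ∀ X → column (suc j) X ≡ column j (map (drop 1) X)
  column-drop []            = refl
  column-drop ([] ∷ X)      = column-drop X
  column-drop ((_ ∷ r) ∷ X) with nth j r
  ... | just v  = cong (v ∷_) (column-drop X)
  ... | nothing = column-drop X
  column-filter : ∀ Z → column j Z ≡ column j (filter nonempty? Z)
  column-filter []            = refl
  column-filter ([] ∷ Z)      = column-filter Z
  column-filter ((x ∷ r) ∷ Z) with nth j (x ∷ r)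
  ... | just v  = cong (v ∷_) (column-filter Z)
  ... | nothing = column-filter Z

peel-partition : ∀ X → Decreasing X → PartitionRows (peel X)
peel-partition X d = decreasing , nonempty (map (drop 1) X)
  where
  decreasing : Decreasing (peel X)
  decreasing = Linkedₚ.map⁺ (Linkedₚ.filter⁺ nonempty? (λ x≥y y≥z → ℕₚ.≤-trans y≥z x≥y)
    (Linkedₚ.map⁺ (Linked.map (λ {r} {r′} le → subst₂ _≥_ (sym (Listₚ.length-drop 1 r)) (sym (Listₚ.length-drop 1 r′))
                                                   (ℕₚ.∸-monoˡ-≤ 1 le))
                              (Linkedₚ.map⁻ d))))
  nonempty : ∀ Z → All (λ r → 0 < length r) (filter nonempty? Z)
  nonempty []            = []
  nonempty ([] ∷ Z)      = nonempty Z
  nonempty ((_ ∷ _) ∷ Z) = s≤s z≤n ∷ nonempty Z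

concat-peel-↭ : ∀ X → All (λ r → 0 < length r) X → concat X ↭ column 0 X ++ concat (peel X)
concat-peel-↭ X nonempty = ↭-trans (split-heads X nonempty) (↭-reflexive (cong (column 0 X ++_) (concat-filter (map (drop 1) X))))
  where
  split-heads : ∀ X → All (λ r → 0 < length r) X → concat X ↭ column 0 X ++ concat (map (drop 1) X)
  split-heads []            []       = ↭-refl
  split-heads ((h ∷ t) ∷ X) (_ ∷ ps) =
    prep h (↭-trans (Permₚ.++⁺ˡ t (split-heads X ps)) (Permₚ.shifts t (column 0 X)))
  concat-filter : ∀ Z → concat Z ≡ concat (filter nonempty? Z)
  concat-filter []            = refl
  concat-filter ([] ∷ Z)      = concat-filter Z
  concat-filter ((x ∷ r) ∷ Z) = cong (λ z → x ∷ r ++ z) (concat-filter Z)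

peel-thin : ∀ X → All (λ r → length r ≤ 1) X → peel X ≡ []
peel-thin []                []              = refl
peel-thin ([] ∷ X)          (_ ∷ ps)        = peel-thin X ps
peel-thin ((_ ∷ []) ∷ X)    (_ ∷ ps)        = peel-thin X ps
peel-thin ((_ ∷ _ ∷ _) ∷ X) (s≤s () ∷ _)

concat-columns-↭ : ∀ L X → length (rowAt X 0) ≡ L → PartitionRows X → concat (applyUpTo (λ j → column j X) L) ↭ concat X
concat-columns-↭ zero    []              _  _              = ↭-refl
concat-columns-↭ zero    ([] ∷ X)        _  (_ , () ∷ _)
concat-columns-↭ (suc L) (r ∷ X)         len (d , nonempty) = begin
  column 0 (r ∷ X) ++ concat (applyUpTo (λ j → column (suc j) (r ∷ X)) L)
    ≡⟨ cong (λ cs → column 0 (r ∷ X) ++ concat cs) (applyUpTo-cong L (column-peel (r ∷ X))) ⟩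
  column 0 (r ∷ X) ++ concat (applyUpTo (λ j → column j (peel (r ∷ X))) L)
    ↭⟨ Permₚ.++⁺ˡ (column 0 (r ∷ X)) (concat-columns-↭ L (peel (r ∷ X)) (length-peel r len (Decreasing-head r X d))
                                                       (peel-partition (r ∷ X) d)) ⟩
  column 0 (r ∷ X) ++ concat (peel (r ∷ X))
    ↭⟨ concat-peel-↭ (r ∷ X) nonempty ⟨
  concat (r ∷ X) ∎
  where
  open PermutationReasoning
  length-peel : ∀ r → length r ≡ suc L → All (λ r′ → length r′ ≤ length r) X → length (rowAt (peel (r ∷ X)) 0) ≡ L
  length-peel (_ ∷ [])     refl shorter rewrite peel-thin X shorter = refl
  length-peel (_ ∷ _ ∷ _)  len  _       = ℕₚ.suc-injective len

Linked-nth⇒ : ∀ {R : ℕ → ℕ → Set} {r : Word} x {p q} → Linked R r → nth x r ≡ just p → nth (suc x) r ≡ just q → R p q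
Linked-nth⇒ {r = _ ∷ _ ∷ _} zero    (rel ∷ _) refl refl = rel
Linked-nth⇒ {r = _ ∷ _ ∷ _} (suc x) (_ ∷ l)   e₁   e₂   = Linked-nth⇒ x l e₁ e₂

Linked-nth⇐ : ∀ {R : ℕ → ℕ → Set} (r : Word) → (∀ x {p q} → nth x r ≡ just p → nth (suc x) r ≡ just q → R p q) → Linked R r
Linked-nth⇐ []          h = []
Linked-nth⇐ (a ∷ [])    h = [-]
Linked-nth⇐ (a ∷ b ∷ r) h = h 0 refl refl ∷ Linked-nth⇐ (b ∷ r) (λ x → h (suc x))

ColStrict-nth⇒ : ∀ {L U : Word} x {p q} → ColStrict L U → nth x L ≡ just p → nth x U ≡ just q → p < q
ColStrict-nth⇒ {_ ∷ _} {_ ∷ _} zero    (lt ∷ _) refl refl = lt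
ColStrict-nth⇒ {_ ∷ _} {_ ∷ _} (suc x) (_ ∷ c)  e₁   e₂   = ColStrict-nth⇒ x c e₁ e₂

ColStrict-nth⇐ : ∀ (L U : Word) → (∀ x {p q} → nth x L ≡ just p → nth x U ≡ just q → p < q) → ColStrict L U
ColStrict-nth⇐ []      U       h = []
ColStrict-nth⇐ (l ∷ L) []      h = []
ColStrict-nth⇐ (l ∷ L) (u ∷ U) h = h 0 refl refl ∷ ColStrict-nth⇐ L U (λ x → h (suc x))

ColStrict-[] : ∀ r → ColStrict r []
ColStrict-[] []      = []
ColStrict-[] (_ ∷ _) = []

Linked-rowAt⇒ : ∀ {R : Word → Word → Set} {X : List Word} → Linked R X → (∀ r → R r []) → ∀ i → R (rowAt X i) (rowAt X (suc i))
Linked-rowAt⇒ {X = []}        _        h i       = h []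
Linked-rowAt⇒ {X = z ∷ []}    _        h zero    = h z
Linked-rowAt⇒ {X = z ∷ []}    _        h (suc i) = h []
Linked-rowAt⇒ {X = _ ∷ _ ∷ _} (r ∷ _)  h zero    = r
Linked-rowAt⇒ {X = _ ∷ _ ∷ _} (_ ∷ l)  h (suc i) = Linked-rowAt⇒ l h i

Linked-rowAt⇐ : ∀ {R : Word → Word → Set} (X : List Word) → (∀ i → R (rowAt X i) (rowAt X (suc i))) → Linked R X
Linked-rowAt⇐ []          h = []
Linked-rowAt⇐ (z ∷ [])    h = [-]
Linked-rowAt⇐ (z ∷ z′ ∷ X) h = h 0 ∷ Linked-rowAt⇐ (z′ ∷ X) (λ i → h (suc i))

All-rowAt⇐ : ∀ {P : Word → Set} (X : List Word) → (∀ i → P (rowAt X i)) → All P X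
All-rowAt⇐ []      h = []
All-rowAt⇐ (z ∷ X) h = h 0 ∷ All-rowAt⇐ X (λ i → h (suc i))

transposeRows-semistandard : ∀ {X} → Decreasing X → All (Linked _<_) X → Linked ColStrict X →
                             All Sorted (transposeRows X) × Linked ColStrict (transposeRows X)
transposeRows-semistandard {X} d strict columns =
  All-rowAt⇐ (transposeRows X) (λ j → subst Sorted (sym (rowAt-transposeRows X j d)) (sorted j)) ,
  Linked-rowAt⇐ (transposeRows X) (λ j → subst₂ ColStrict (sym (rowAt-transposeRows X j d))
                                                     (sym (rowAt-transposeRows X (suc j) d)) (column-strict j))
  where
  sorted : ∀ j → Sorted (column j X)
  sorted j = Linked-nth⇐ (column j X) λ i e₁ e₂ →
    ℕₚ.<⇒≤ (ColStrict-nth⇒ j (Linked-rowAt⇒ columns ColStrict-[] i)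
              (trans (sym (nth-column X i j d)) e₁) (trans (sym (nth-column X (suc i) j d)) e₂))
  column-strict : ∀ j → ColStrict (column j X) (column (suc j) X)
  column-strict j = ColStrict-nth⇐ (column j X) (column (suc j) X) λ i e₁ e₂ →
    Linked-nth⇒ j (All-rowAt i strict []) (trans (sym (nth-column X i j d)) e₁) (trans (sym (nth-column X i (suc j) d)) e₂)

zip⇒Linked : ∀ (rs : List Word) → All (λ p → ColStrict (proj₁ p) (proj₂ p)) (zip rs (drop 1 rs)) → Linked ColStrict rs
zip⇒Linked []            _        = []
zip⇒Linked (r ∷ [])      _        = [-]
zip⇒Linked (r ∷ r′ ∷ rs) (c ∷ cs) = c ∷ zip⇒Linked (r′ ∷ rs) cs

Linked⇒zip : ∀ {rs : List Word} → Linked ColStrict rs → All (λ p → ColStrict (proj₁ p) (proj₂ p)) (zip rs (drop 1 rs))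
Linked⇒zip []       = []
Linked⇒zip [-]      = []
Linked⇒zip (c ∷ cs) = c ∷ Linked⇒zip cs

concat-reverse-∷ : ∀ (z : Word) Zs → concat (reverse (z ∷ Zs)) ≡ concat (reverse Zs) ++ z
concat-reverse-∷ z Zs = begin
  concat (reverse (z ∷ Zs))         ≡⟨ cong concat (Listₚ.unfold-reverse z Zs) ⟩
  concat (reverse Zs ++ z ∷ [])     ≡⟨ Listₚ.concat-++ (reverse Zs) (z ∷ []) ⟨
  concat (reverse Zs) ++ z ++ []    ≡⟨ cong (concat (reverse Zs) ++_) (Listₚ.++-identityʳ z) ⟩
  concat (reverse Zs) ++ z          ∎
  where open ≡-Reasoning

reverse-++-∷ : ∀ {A : Set} (xs : List A) y zs → reverse (xs ++ y ∷ zs) ≡ reverse zs ++ y ∷ reverse xs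
reverse-++-∷ xs y zs = trans (Listₚ.reverse-++ xs (y ∷ zs))
  (trans (cong (_++ reverse xs) (Listₚ.unfold-reverse y zs)) (Listₚ.++-assoc (reverse zs) (y ∷ []) (reverse xs)))

concat-reverse-↭ : ∀ (Z : List Word) → concat (reverse Z) ↭ concat Z
concat-reverse-↭ []      = ↭-refl
concat-reverse-↭ (z ∷ Z) = begin
  concat (reverse (z ∷ Z))         ≡⟨ concat-reverse-∷ z Z ⟩
  concat (reverse Z) ++ z          ↭⟨ Permₚ.++-comm (concat (reverse Z)) z ⟩
  z ++ concat (reverse Z)          ↭⟨ Permₚ.++⁺ˡ z (concat-reverse-↭ Z) ⟩
  z ++ concat Z                    ∎
  where open PermutationReasoning

module _ {t : Tableau} (wf : WellFormed t) where

  private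
    X = rows t

  rows-partition : PartitionRows X
  rows-partition = subst (Linked _≥_) (sym (shape-rows t (proj₂ wf))) (proj₁ (proj₁ wf))
                 , Allₚ.map⁻ (subst (All (0 <_)) (sym (shape-rows t (proj₂ wf))) (proj₂ (proj₁ wf)))

  transpose-involutive : transpose (transpose t) ≡ t
  transpose-involutive = begin
    fromRows (transposeRows (rows (fromRows (transposeRows X)))) ≡⟨ cong (fromRows ∘ transposeRows) (rows-fromRows (transposeRows X)) ⟩
    fromRows (transposeRows (transposeRows X))                   ≡⟨ cong fromRows (transposeRows-involutive X rows-partition) ⟩
    fromRows X                                                   ≡⟨ fromRows-rows t (proj₂ wf) ⟩
    t                                                            ∎
    where
    open ≡-Reasoning

  word-transpose-↭ : word (transpose t) ↭ word t
  word-transpose-↭ = begin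
    concat (reverse (transposeRows X))                           ↭⟨ concat-reverse-↭ (transposeRows X) ⟩
    concat (transposeRows X)                                     ↭⟨ concat-columns-↭ _ X refl rows-partition ⟩
    concat X                                                     ↭⟨ concat-reverse-↭ X ⟨
    concat (reverse X)                                           ≡⟨ word-rows t (proj₂ wf) ⟩
    word t                                                       ∎
    where open PermutationReasoning

  transpose-wellFormed : WellFormed (transpose t)
  transpose-wellFormed = (transposeRows-decreasing X , Allₚ.map⁺ (transposeRows-nonempty X)) , fromRows-fills (transposeRows X)

count-upTo-∉ : ∀ n {p} → (∀ {i} → i < n → suc i ≢ p) → count p (applyUpTo suc n) ≡ 0
count-upTo-∉ n ∉ = count-none (Allₚ.applyUpTo⁺₁ suc n ∉)

count-upTo-∈ : ∀ n {p} → 1 ≤ p → p ≤ n → count p (applyUpTo suc n) ≡ 1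
count-upTo-∈ zero    (s≤s _) ()
count-upTo-∈ (suc n) {p} 1≤p p≤1+n = begin
  count p (applyUpTo suc (suc n))                   ≡⟨ cong (count p) (Listₚ.applyUpTo-∷ʳ suc n) ⟨
  count p (applyUpTo suc n ++ suc n ∷ [])           ≡⟨ count-++ p (applyUpTo suc n) (suc n ∷ []) ⟩
  count p (applyUpTo suc n) + count p (suc n ∷ [])  ≡⟨ last-or-earlier ⟩
  1                                                 ∎
  where
  open ≡-Reasoning
  last-or-earlier : count p (applyUpTo suc n) + count p (suc n ∷ []) ≡ 1
  last-or-earlier with p ℕₚ.≟ suc n
  ... | yes refl = cong₂ _+_ (count-upTo-∉ n (λ i<n → ℕₚ.<⇒≢ (s≤s i<n))) (count-hit (suc n) [])
  ... | no  p≢   = cong₂ _+_ (count-upTo-∈ n 1≤p (ℕₚ.≤-pred (ℕₚ.≤∧≢⇒< p≤1+n p≢))) (count-miss [] (p≢ ∘ sym))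

count-upTo-≤1 : ∀ n p → count p (applyUpTo suc n) ≤ 1
count-upTo-≤1 n zero = ℕₚ.≤-trans (ℕₚ.≤-reflexive (count-upTo-∉ n (λ _ ()))) z≤n
count-upTo-≤1 n (suc q) with suc q ℕₚ.≤? n
... | yes le = ℕₚ.≤-reflexive (count-upTo-∈ n (s≤s z≤n) le)
... | no  gt = ℕₚ.≤-trans (ℕₚ.≤-reflexive (count-upTo-∉ n (λ i<n → ℕₚ.<⇒≢ (ℕₚ.<-≤-trans (s≤s i<n) (ℕₚ.≰⇒> gt))))) z≤n

module _ (T : Tableau) (std : IsStandard T) where

  private
    letters′ : word T ↭ applyUpTo suc (degree T)
    letters′ = ↭-trans (proj₂ std) (↭-reflexive (Listₚ.map-applyUpTo (λ i → i) suc (degree T)))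

  standard-InRange : InRange (degree T) (word T)
  standard-InRange = Permₚ.All-resp-↭ (↭-sym letters′) (Allₚ.applyUpTo⁺₁ suc (degree T) (λ i<n → s≤s z≤n , i<n))

  standard-count : ∀ {p} → 1 ≤ p → p ≤ degree T → count p (word T) ≡ 1
  standard-count 1≤p p≤n = trans (count-↭ _ letters′) (count-upTo-∈ (degree T) 1≤p p≤n)

  standard-count-≤1 : ∀ p → count p (word T) ≤ 1
  standard-count-≤1 p = subst (_≤ 1) (sym (count-↭ p letters′)) (count-upTo-≤1 (degree T) p)

sorted-distinct⇒strict : ∀ {r} → Sorted r → (∀ p → count p r ≤ 1) → Linked _<_ r
sorted-distinct⇒strict []                  _    = []
sorted-distinct⇒strict [-]                 _    = [-]
sorted-distinct⇒strict {x ∷ y ∷ r} (x≤y ∷ s) once =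
  ℕₚ.≤∧≢⇒< x≤y x≢y ∷ sorted-distinct⇒strict s (λ p → ℕₚ.≤-trans (count-∷-≤ p x (y ∷ r)) (once p))
  where
  x≢y : x ≢ y
  x≢y refl = ℕₚ.<-irrefl refl (ℕₚ.≤-trans (count-two x [] [] r) (once x))

All-count-≤1 : ∀ (X : List Word) → (∀ p → count p (concat X) ≤ 1) → All (λ r → ∀ p → count p r ≤ 1) X
All-count-≤1 []      _    = []
All-count-≤1 (r ∷ X) once =
  (λ p → ℕₚ.≤-trans (ℕₚ.m≤m+n _ _) (apart p)) ∷ All-count-≤1 X (λ p → ℕₚ.≤-trans (ℕₚ.m≤n+m _ _) (apart p))
  where
  apart : ∀ p → count p r + count p (concat X) ≤ 1
  apart p = subst (_≤ 1) (count-++ p r (concat X)) (once p)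

standard-rows-strict : ∀ T → IsStandard T → All (Linked _<_) (rows T)
standard-rows-strict T std@(((_ , fills) , sorted , _) , _) =
  All.zipWith (λ (s , once) → sorted-distinct⇒strict s once) (sorted , All-count-≤1 (rows T) once)
  where
  once : ∀ p → count p (concat (rows T)) ≤ 1
  once p = subst (_≤ 1) (trans (cong (count p) (sym (word-rows T fills))) (count-↭ p (concat-reverse-↭ (rows T))))
                 (standard-count-≤1 T std p)

transpose-standard : ∀ T → IsStandard T → IsStandard (transpose T)
transpose-standard T std@((wf , _ , columns) , letters) =
  (transpose-wellFormed wf , subst (All Sorted) (sym rows-transpose) (proj₁ semistandard)
                           , subst (λ rs → All _ (zip rs (drop 1 rs))) (sym rows-transpose) (Linked⇒zip (proj₂ semistandard)))
  , ↭-trans (word-transpose-↭ wf) (subst (λ n → word T ↭ map suc (upTo n)) (sym same-degree) letters)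
  where
  X = rows T
  rows-transpose : rows (transpose T) ≡ transposeRows X
  rows-transpose = rows-fromRows (transposeRows X)
  semistandard : All Sorted (transposeRows X) × Linked ColStrict (transposeRows X)
  semistandard = transposeRows-semistandard (proj₁ (rows-partition wf)) (standard-rows-strict T std) (zip⇒Linked X columns)
  same-degree : degree (transpose T) ≡ degree T
  same-degree = Permₚ.↭-length (word-transpose-↭ wf)

-- Semistandardness along σₙ ⋯ σ₁

++-split : ∀ (t Z A B : Word) y → t ++ Z ≡ A ++ y ∷ B →
           (∃ λ U → ∃ λ V → t ≡ U ++ y ∷ V × A ≡ U × B ≡ V ++ Z) ⊎ (∃ λ A′ → A ≡ t ++ A′ × Z ≡ A′ ++ y ∷ B)
++-split []      Z A       B y eq = inj₂ (A , refl , eq)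
++-split (x ∷ t) Z []      B y eq with refl , e ← Listₚ.∷-injective eq = inj₁ ([] , t , refl , refl , sym e)
++-split (x ∷ t) Z (_ ∷ A) B y eq with refl , e ← Listₚ.∷-injective eq with ++-split t Z A B y e
... | inj₁ (U , V , refl , refl , B≡) = inj₁ (x ∷ U , V , refl , refl , B≡)
... | inj₂ (A′ , refl , Z≡)           = inj₂ (A′ , refl , Z≡)

concat-split : ∀ (ts : List Word) A y B → concat ts ≡ A ++ y ∷ B →
               ∃ λ ts₁ → ∃ λ U → ∃ λ V → ∃ λ ts₂ →
                 ts ≡ ts₁ ++ (U ++ y ∷ V) ∷ ts₂ × A ≡ concat ts₁ ++ U × B ≡ V ++ concat ts₂
concat-split []       []      y B ()
concat-split []       (_ ∷ _) y B ()
concat-split (t ∷ ts) A       y B eq with ++-split t (concat ts) A B y eq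
... | inj₁ (U , V , t≡ , A≡ , B≡) = [] , U , V , ts , cong (_∷ ts) t≡ , A≡ , B≡
... | inj₂ (A′ , A≡ , rest) with concat-split ts A′ y B rest
...   | ts₁ , U , V , ts₂ , refl , refl , B≡ =
  t ∷ ts₁ , U , V , ts₂ , refl , trans A≡ (sym (Listₚ.++-assoc t (concat ts₁) U)) , B≡

map-length-++-∷ : ∀ (P : List Word) U {y y′} V Q → map length (P ++ (U ++ y′ ∷ V) ∷ Q) ≡ map length (P ++ (U ++ y ∷ V) ∷ Q)
map-length-++-∷ P U V Q = trans (Listₚ.map-++ length P _)
  (trans (cong (λ n → map length P ++ n ∷ map length Q) (trans (Listₚ.length-++ U) (sym (Listₚ.length-++ U))))
         (sym (Listₚ.map-++ length P _)))

reading-++-∷ : ∀ (ts₁ : List Word) U y V ts₂ →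
               concat (reverse (reverse ts₂ ++ (U ++ y ∷ V) ∷ reverse ts₁)) ≡ (concat ts₁ ++ U) ++ y ∷ V ++ concat ts₂
reading-++-∷ ts₁ U y V ts₂ = begin
  concat (reverse (reverse ts₂ ++ (U ++ y ∷ V) ∷ reverse ts₁))        ≡⟨ cong concat (reverse-++-∷ (reverse ts₂) _ (reverse ts₁)) ⟩
  concat (reverse (reverse ts₁) ++ (U ++ y ∷ V) ∷ reverse (reverse ts₂))
    ≡⟨ cong₂ (λ p q → concat (p ++ (U ++ y ∷ V) ∷ q)) (Listₚ.reverse-involutive ts₁) (Listₚ.reverse-involutive ts₂) ⟩
  concat (ts₁ ++ (U ++ y ∷ V) ∷ ts₂)                                  ≡⟨ Listₚ.concat-++ ts₁ _ ⟨
  concat ts₁ ++ (U ++ y ∷ V) ++ concat ts₂                            ≡⟨ cong (concat ts₁ ++_) (Listₚ.++-assoc U (y ∷ V) (concat ts₂)) ⟩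
  concat ts₁ ++ U ++ y ∷ V ++ concat ts₂                              ≡⟨ Listₚ.++-assoc (concat ts₁) U _ ⟨
  (concat ts₁ ++ U) ++ y ∷ V ++ concat ts₂                            ∎
  where open ≡-Reasoning

-- The cell between A and B of the reading word: changing its letter changes only its row U ++ _ ∷ V.
record Cell (μ : List ℕ) (A B : Word) : Set where
  field
    below above : List Word
    U V         : Word
    rows-at     : ∀ y → rows (tab μ (A ++ y ∷ B)) ≡ below ++ (U ++ y ∷ V) ∷ above
    prefix      : A ≡ concat (reverse above) ++ U
    suffix      : B ≡ V ++ concat (reverse below)

cell : ∀ μ A y B → length (A ++ y ∷ B) ≡ sum μ → Cell μ A B
cell μ A y B fills with concat-split (reverse (rows t)) A y B (word-rows t fills)
  where t = tab μ (A ++ y ∷ B)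
... | ts₁ , U , V , ts₂ , ts≡ , refl , refl = record
  { below   = reverse ts₂
  ; above   = reverse ts₁
  ; U       = U
  ; V       = V
  ; rows-at = λ y′ → rows-tab (row-list y′) (shape-at y′) (reading-at y′)
  ; prefix  = cong (_++ U) (cong concat (sym (Listₚ.reverse-involutive ts₁)))
  ; suffix  = cong (V ++_) (cong concat (sym (Listₚ.reverse-involutive ts₂)))
  }
  where
  t = tab μ ((concat ts₁ ++ U) ++ y ∷ V ++ concat ts₂)
  row-list : ℕ → List Word
  row-list y′ = reverse ts₂ ++ (U ++ y′ ∷ V) ∷ reverse ts₁
  rows-t : rows t ≡ row-list y
  rows-t = begin
    rows t                       ≡⟨ Listₚ.reverse-involutive (rows t) ⟨
    reverse (reverse (rows t))   ≡⟨ cong reverse ts≡ ⟩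
    reverse (ts₁ ++ _ ∷ ts₂)     ≡⟨ reverse-++-∷ ts₁ _ ts₂ ⟩
    row-list y                   ∎
    where open ≡-Reasoning
  shape-at : ∀ y′ → map length (row-list y′) ≡ μ
  shape-at y′ = trans (map-length-++-∷ (reverse ts₂) U V (reverse ts₁))
                      (trans (cong (map length) (sym rows-t)) (shape-rows t fills))
  reading-at : ∀ y′ → concat (reverse (row-list y′)) ≡ (concat ts₁ ++ U) ++ y′ ∷ V ++ concat ts₂
  reading-at y′ = reading-++-∷ ts₁ U y′ V ts₂

module _ {A : Set} where

  All-++-∷-replace : ∀ {Q : A → Set} P {x y S} → All Q (P ++ x ∷ S) → Q y → All Q (P ++ y ∷ S)
  All-++-∷-replace []      (_ ∷ qs) qy = qy ∷ qs
  All-++-∷-replace (_ ∷ P) (q ∷ qs) qy = q ∷ All-++-∷-replace P qs qy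

  All-++-∷⁻ : ∀ {Q : A → Set} P {x S} → All Q (P ++ x ∷ S) → Q x
  All-++-∷⁻ P qs = All.head (Allₚ.++⁻ʳ P qs)

  Linked-++⁻ʳ : ∀ {R : A → A → Set} P {Q} → Linked R (P ++ Q) → Linked R Q
  Linked-++⁻ʳ []           l       = l
  Linked-++⁻ʳ (_ ∷ [])     {[]} _  = []
  Linked-++⁻ʳ (_ ∷ [])     {_ ∷ _} (_ ∷ l) = l
  Linked-++⁻ʳ (_ ∷ _ ∷ P)  (_ ∷ l) = Linked-++⁻ʳ (_ ∷ P) l

  Linked-++-∷∷⁻ : ∀ {R : A → A → Set} P {x y Q} → Linked R (P ++ x ∷ y ∷ Q) → R x y
  Linked-++-∷∷⁻ P l = Linked.head (Linked-++⁻ʳ P l)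

  Linked-++-∷-replace : ∀ {R : A → A → Set} P {x y Q} → Linked R (P ++ x ∷ Q) →
                        (∀ P′ d → P ≡ P′ ++ d ∷ [] → R d y) → (∀ {e} → R x e → R y e) → Linked R (P ++ y ∷ Q)
  Linked-++-∷-replace []          {Q = []}    _        _    _  = [-]
  Linked-++-∷-replace []          {Q = _ ∷ _} (r ∷ l)  _    up = up r ∷ l
  Linked-++-∷-replace (p ∷ [])    (_ ∷ l)     down up = down [] p refl ∷ Linked-++-∷-replace [] l (λ { [] _ () ; (_ ∷ _) _ () }) up
  Linked-++-∷-replace (p ∷ p′ ∷ P) (r ∷ l)    down up =
    r ∷ Linked-++-∷-replace (p′ ∷ P) l (λ P′ d e → down (p ∷ P′) d (cong (p ∷_) e)) up

Sorted-∷⇒All : ∀ {y V} → Sorted (y ∷ V) → All (y ≤_) V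
Sorted-∷⇒All [-]     = []
Sorted-∷⇒All (r ∷ l) = Linkedₚ.Linked⇒All ℕₚ.≤-trans r l

Sorted-++-∷⇒All-≤ : ∀ D₁ {d D₂} → Sorted (D₁ ++ d ∷ D₂) → All (_≤ d) D₁
Sorted-++-∷⇒All-≤ []       s = []
Sorted-++-∷⇒All-≤ (x ∷ D₁) s = All-++-∷⁻ D₁ (Sorted-∷⇒All s) ∷ Sorted-++-∷⇒All-≤ D₁ (Linked.tail s)

Sorted-++-∷⇒All-≥ : ∀ U {y V} → Sorted (U ++ y ∷ V) → All (y ≤_) V
Sorted-++-∷⇒All-≥ U s = Sorted-∷⇒All (Linked-++⁻ʳ U s)

ColStrict-at : ∀ D₁ {d D₂} U {y V} → ColStrict (D₁ ++ d ∷ D₂) (U ++ y ∷ V) → length D₁ ≡ length U → d < y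
ColStrict-at []       []      (lt ∷ _) _ = lt
ColStrict-at (_ ∷ D₁) (_ ∷ U) (_ ∷ c)  e = ColStrict-at D₁ U c (ℕₚ.suc-injective e)

ColStrict-replace-lower : ∀ U {a b V E} → ColStrict (U ++ b ∷ V) E → a ≤ b → ColStrict (U ++ a ∷ V) E
ColStrict-replace-lower []      {E = []}    _        _    = []
ColStrict-replace-lower []      {E = _ ∷ _} (lt ∷ c) a≤b = ℕₚ.≤-<-trans a≤b lt ∷ c
ColStrict-replace-lower (_ ∷ U) {E = []}    _        _    = []
ColStrict-replace-lower (_ ∷ U) {E = _ ∷ _} (lt ∷ c) a≤b = lt ∷ ColStrict-replace-lower U c a≤b

ColStrict-replace-upper : ∀ D U {a b V} → ColStrict D (U ++ b ∷ V) →
                          (∀ D₁ d D₂ → D ≡ D₁ ++ d ∷ D₂ → length D₁ ≡ length U → d < a) → ColStrict D (U ++ a ∷ V)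
ColStrict-replace-upper []      U       _        _     = []
ColStrict-replace-upper (d ∷ D) []      (_ ∷ c)  below = below [] d D refl refl ∷ c
ColStrict-replace-upper (d ∷ D) (_ ∷ U) (lt ∷ c) below =
  lt ∷ ColStrict-replace-upper D U c (λ D₁ d′ D₂ e l → below (d ∷ D₁) d′ D₂ (cong (d ∷_) e) (cong suc l))

LastIsNot : ℕ → Word → Set
LastIsNot b X = ∀ Z → X ≢ Z ++ b ∷ []

OnlyInBA : ℕ → ℕ → Word → Set
OnlyInBA a b Y = ∀ P Q → P ++ a ∷ Q ≡ Y → P ≡ b ∷ [] × Q ≡ []

++-≡-singleton : ∀ (xs ys : Word) {b} → xs ++ ys ≡ b ∷ [] → (xs ≡ [] × ys ≡ b ∷ []) ⊎ (xs ≡ b ∷ [] × ys ≡ [])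
++-≡-singleton []          ys e  = inj₁ (refl , e)
++-≡-singleton (x ∷ [])    [] e  = inj₂ (e , refl)
++-≡-singleton (x ∷ [])    (_ ∷ _) ()
++-≡-singleton (x ∷ _ ∷ _) ys ()

sub-head-of-sorted : ∀ a {v V} → suc a ≤ v → Sorted (v ∷ V) → sub (inAB a) (v ∷ V) ≡ suc a ∷ [] → v ≡ suc a
sub-head-of-sorted a {v} {V} b≤v s e with true-or-false (inAB a v)
... | inj₁ in-ab = Listₚ.∷-injectiveˡ (trans (sym (sub-accept (inAB a) {v} V in-ab)) e)
... | inj₂ not-ab = ⊥-elim (b≢v (ℕₚ.≤-antisym b≤v v≤b))
  where
  v≤b : v ≤ suc a
  v≤b = All.head (subst (All (v ≤_)) (trans (sym (sub-reject (inAB a) {v} V not-ab)) e)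
                        (Allₚ.filter⁺ _ (Sorted-∷⇒All s)))
  b≢v : suc a ≢ v
  b≢v refl with () ← trans (sym (inAB-b a)) not-ab

b-not-left-of-a : ∀ a D₁ {D₂} → Sorted (D₁ ++ a ∷ D₂) → sub (inAB a) D₁ ≢ suc a ∷ []
b-not-left-of-a a D₁ sD sub-D₁ =
  ℕₚ.1+n≰n (All.head (subst (All (_≤ a)) sub-D₁ (Allₚ.filter⁺ _ (Sorted-++-∷⇒All-≤ D₁ sD))))

a-not-below-b : ∀ a D₁ D₂ U V → Sorted (D₁ ++ a ∷ D₂) → ColStrict (D₁ ++ a ∷ D₂) (U ++ suc a ∷ suc a ∷ V) →
                length (U ++ suc a ∷ suc a ∷ V) ≤ length (D₁ ++ a ∷ D₂) → length D₁ ≡ length U →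
                sub (inAB a) D₂ ≢ []
a-not-below-b a D₁ [] U V _ _ long same _ = ℕₚ.<-irrefl refl (begin-strict
  length (D₁ ++ a ∷ [])          ≡⟨ Listₚ.length-++ D₁ ⟩
  length D₁ + 1                  ≡⟨ cong (_+ 1) same ⟩
  length U + 1                   <⟨ ℕₚ.+-monoʳ-< (length U) (s≤s (s≤s z≤n)) ⟩
  length U + (2 + length V)      ≡⟨ Listₚ.length-++ U ⟨
  length (U ++ suc a ∷ suc a ∷ V) ≤⟨ long ⟩
  length (D₁ ++ a ∷ [])          ∎)
  where open ℕₚ.≤-Reasoning
a-not-below-b a D₁ (d₂ ∷ D₂) U V sD cDR long same sub-D₂ with ℕₚ.≤-antisym (ℕₚ.≤-pred d₂<b) (Linked-++-∷∷⁻ D₁ sD)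
  where
  d₂<b : d₂ < suc a
  d₂<b = ColStrict-at (D₁ ++ a ∷ []) (U ++ suc a ∷ [])
           (subst₂ ColStrict (sym (Listₚ.++-assoc D₁ (a ∷ []) (d₂ ∷ D₂))) (sym (Listₚ.++-assoc U (suc a ∷ []) (suc a ∷ V))) cDR)
           (trans (Listₚ.length-++ D₁) (trans (cong (_+ 1) same) (sym (Listₚ.length-++ U))))
... | refl with () ← trans (sym (sub-accept (inAB a) {a} D₂ (inAB-a a))) sub-D₂

-- Under the changed b the cell can be an a only if, by OnlyInBA, a second b follows it in its row;
-- the cell under that b lies in [a, b) but cannot be another a.
a-not-below : ∀ a D₁ D₂ U V C → Sorted (D₁ ++ a ∷ D₂) → Sorted (U ++ suc a ∷ V) →
              ColStrict (D₁ ++ a ∷ D₂) (U ++ suc a ∷ V) → length (U ++ suc a ∷ V) ≤ length (D₁ ++ a ∷ D₂) →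
              length D₁ ≡ length U → OnlyInBA a (suc a) (sub (inAB a) (V ++ (D₁ ++ a ∷ D₂) ++ C)) → ⊥
a-not-below a D₁ D₂ U V C sD sR cDR long same only with only _ _ (sym subword)
  where
  p = inAB a
  subword : sub p (V ++ (D₁ ++ a ∷ D₂) ++ C) ≡ (sub p V ++ sub p D₁) ++ a ∷ (sub p D₂ ++ sub p C)
  subword = begin
    sub p (V ++ (D₁ ++ a ∷ D₂) ++ C)             ≡⟨ cong (λ z → sub p (V ++ z)) (Listₚ.++-assoc D₁ (a ∷ D₂) C) ⟩
    sub p (V ++ D₁ ++ a ∷ D₂ ++ C)               ≡⟨ cong (sub p) (Listₚ.++-assoc V D₁ _) ⟨
    sub p ((V ++ D₁) ++ a ∷ D₂ ++ C)             ≡⟨ sub-++-∷ p (V ++ D₁) (D₂ ++ C) (inAB-a a) ⟩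
    sub p (V ++ D₁) ++ a ∷ sub p (D₂ ++ C)       ≡⟨ cong₂ (λ l r → l ++ a ∷ r) (sub-++ p V D₁) (sub-++ p D₂ C) ⟩
    (sub p V ++ sub p D₁) ++ a ∷ (sub p D₂ ++ sub p C) ∎
    where open ≡-Reasoning
... | before , after with ++-≡-singleton (sub (inAB a) V) (sub (inAB a) D₁) before
...   | inj₁ (_ , sub-D₁) = b-not-left-of-a a D₁ sD sub-D₁
...   | inj₂ (sub-V , _) with V
...     | [] with () ← sub-V
...     | v ∷ V′
  with refl ← sub-head-of-sorted a (All.head (Sorted-++-∷⇒All-≥ U sR)) (Linked.tail (Linked-++⁻ʳ U sR)) sub-V
  = a-not-below-b a D₁ D₂ U V′ sD cDR long same (Listₚ.++-conicalˡ _ _ after)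

below-cell : ∀ a D U V C → Sorted D → Sorted (U ++ suc a ∷ V) → ColStrict D (U ++ suc a ∷ V) →
             length (U ++ suc a ∷ V) ≤ length D → OnlyInBA a (suc a) (sub (inAB a) (V ++ D ++ C)) →
             ColStrict D (U ++ a ∷ V)
below-cell a D U V C sD sR cDR long only = ColStrict-replace-upper D U cDR cell<a
  where
  cell<a : ∀ D₁ d D₂ → D ≡ D₁ ++ d ∷ D₂ → length D₁ ≡ length U → d < a
  cell<a D₁ d D₂ D≡ same with d ℕₚ.≟ a
  ... | no  d≢a  = ℕₚ.≤∧≢⇒< (ℕₚ.≤-pred (ColStrict-at D₁ U (subst (λ D → ColStrict D _) D≡ cDR) same)) d≢a
  ... | yes refl = ⊥-elim (a-not-below a D₁ D₂ U V C (subst Sorted D≡ sD) sR (subst (λ D → ColStrict D _) D≡ cDR)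
                             (subst (λ D → _ ≤ length D) D≡ long) same
                             (subst (λ D → OnlyInBA a (suc a) (sub (inAB a) (V ++ D ++ C))) D≡ only))

-- The invariant maintained along σₙ ⋯ σ₁, k being the letter currently doubled.
record Doubled (μ : List ℕ) (k : ℕ) (w : Word) : Set where
  field
    fills     : length w ≡ sum μ
    partition : IsPartition μ
    sorted    : All Sorted (rows (tab μ w))
    columns   : Linked ColStrict (rows (tab μ w))
    twice     : count k w ≡ 2
    once      : ∀ {x} → 1 ≤ x → x < k → count x w ≡ 1
    positive  : Positive w

lower-in-row : ∀ a A₀ U V → Sorted (U ++ suc a ∷ V) → LastIsNot (suc a) (sub (inAB a) (A₀ ++ U)) → Sorted (U ++ a ∷ V)
lower-in-row a A₀ U V sorted last-not-b = Linked-++-∷-replace U sorted left≤a (ℕₚ.≤-trans (ℕₚ.n≤1+n a))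
  where
  left≤a : ∀ U′ u → U ≡ U′ ++ u ∷ [] → u ≤ a
  left≤a U′ u U≡ = ℕₚ.≤-pred (ℕₚ.≤∧≢⇒< u≤b u≢b)
    where
    u≤b : u ≤ suc a
    u≤b = Linked-++-∷∷⁻ U′ (subst Sorted (trans (cong (_++ suc a ∷ V) U≡) (Listₚ.++-assoc U′ (u ∷ []) (suc a ∷ V))) sorted)
    u≢b : u ≢ suc a
    u≢b refl = last-not-b (sub (inAB a) (A₀ ++ U′)) (begin
      sub (inAB a) (A₀ ++ U)                   ≡⟨ cong (λ z → sub (inAB a) (A₀ ++ z)) U≡ ⟩
      sub (inAB a) (A₀ ++ U′ ++ u ∷ [])        ≡⟨ cong (sub (inAB a)) (Listₚ.++-assoc A₀ U′ _) ⟨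
      sub (inAB a) ((A₀ ++ U′) ++ u ∷ [])      ≡⟨ sub-++-∷ (inAB a) (A₀ ++ U′) [] (inAB-b a) ⟩
      sub (inAB a) (A₀ ++ U′) ++ u ∷ []        ∎)
      where open ≡-Reasoning

lower-in-columns : ∀ a below U V above → let Row = U ++ suc a ∷ V; rs = below ++ Row ∷ above in
                   Decreasing rs → All Sorted rs → Linked ColStrict rs →
                   OnlyInBA a (suc a) (sub (inAB a) (V ++ concat (reverse below))) →
                   Linked ColStrict (below ++ (U ++ a ∷ V) ∷ above)
lower-in-columns a below U V above decreasing sorted columns only = Linked-++-∷-replace below columns down up
  where
  Row = U ++ suc a ∷ V
  up : ∀ {E} → ColStrict Row E → ColStrict (U ++ a ∷ V) E
  up c = ColStrict-replace-lower U c (ℕₚ.n≤1+n a)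
  down : ∀ P′ D → below ≡ P′ ++ D ∷ [] → ColStrict D (U ++ a ∷ V)
  down P′ D below≡ = below-cell a D U V (concat (reverse P′)) sorted-D (All-++-∷⁻ below sorted) column-DR long only′
    where
    rows≡ : below ++ Row ∷ above ≡ P′ ++ D ∷ Row ∷ above
    rows≡ = trans (cong (_++ Row ∷ above) below≡) (Listₚ.++-assoc P′ (D ∷ []) (Row ∷ above))
    sorted-D : Sorted D
    sorted-D = All-++-∷⁻ P′ (subst (All Sorted) rows≡ sorted)
    column-DR : ColStrict D Row
    column-DR = Linked-++-∷∷⁻ P′ (subst (Linked ColStrict) rows≡ columns)
    long : length Row ≤ length D
    long = Linked-++-∷∷⁻ (map length P′)
             (subst (Linked _≥_) (trans (cong (map length) rows≡) (Listₚ.map-++ length P′ _)) decreasing)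
    only′ : OnlyInBA a (suc a) (sub (inAB a) (V ++ D ++ concat (reverse P′)))
    only′ = subst (λ B → OnlyInBA a (suc a) (sub (inAB a) B))
                  (cong (λ z → V ++ concat z) (trans (cong reverse below≡) (Listₚ.reverse-++ P′ (D ∷ []))))
                  only

-- σₐ turns abb, bab, bba into aab, baa, aba: one b = a+1 becomes a, and X = [a], [b,a], [] resp.
-- Y = [b], [], [b,a] are the {a,b}-subwords before and after it.  The left neighbour of that cell is
-- then not b, and no a lies below it, so the filling stays semistandard.
lower-cell : ∀ {μ a} A B → 1 ≤ a → Doubled μ (suc a) (A ++ suc a ∷ B) →
             LastIsNot (suc a) (sub (inAB a) A) → OnlyInBA a (suc a) (sub (inAB a) B) → Doubled μ a (A ++ a ∷ B)
lower-cell {μ} {a} A B 1≤a d last-not-b only = record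
  { fills     = trans (trans (Listₚ.length-++ A) (sym (Listₚ.length-++ A))) fills
  ; partition = partition
  ; sorted    = subst (All Sorted) (sym (rows-at a))
                  (All-++-∷-replace below sorted-rows
                    (lower-in-row a (concat (reverse above)) U V (All-++-∷⁻ below sorted-rows)
                                  (subst (LastIsNot (suc a) ∘ sub (inAB a)) prefix last-not-b)))
  ; columns   = subst (Linked ColStrict) (sym (rows-at a))
                  (lower-in-columns a below U V above decreasing sorted-rows
                    (subst (Linked ColStrict) (rows-at (suc a)) columns)
                    (subst (OnlyInBA a (suc a) ∘ sub (inAB a)) suffix only))
  ; twice     = trans (count-replace-new a (suc a) A B ℕₚ.1+n≢n) (cong suc (once 1≤a (ℕₚ.n<1+n a)))
  ; once      = λ {x} 1≤x x<a → trans (count-replace-other x a (suc a) A B (ℕₚ.>⇒≢ x<a) (ℕₚ.>⇒≢ (ℕₚ.m<n⇒m<1+n x<a)))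
                                      (once 1≤x (ℕₚ.m<n⇒m<1+n x<a))
  ; positive  = All-++-∷-replace A positive 1≤a
  }
  where
  open Doubled d
  open Cell (cell μ A (suc a) B fills)
  sorted-rows : All Sorted (below ++ (U ++ suc a ∷ V) ∷ above)
  sorted-rows = subst (All Sorted) (rows-at (suc a)) sorted
  decreasing : Decreasing (below ++ (U ++ suc a ∷ V) ∷ above)
  decreasing = subst (Linked _≥_) (sym (trans (cong (map length) (sym (rows-at (suc a)))) (shape-rows (tab μ _) fills)))
                     (proj₁ partition)

lower-letter : ∀ {μ a} w X Y → 1 ≤ a → Doubled μ (suc a) w → sub (inAB a) w ≡ X ++ suc a ∷ Y →
               LastIsNot (suc a) X → OnlyInBA a (suc a) Y → Doubled μ a (replaceSub (inAB a) w (X ++ a ∷ Y))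
lower-letter {μ} {a} w X Y 1≤a d s last-not-b only with sub-split (inAB a) w X (suc a) Y s
... | A , B , refl , refl , refl =
  subst (Doubled μ a) (sym (replaceSub-at (inAB a) A (suc a) B a (inAB-b a))) (lower-cell A B 1≤a d last-not-b only)

last-[] : ∀ {b} → LastIsNot b []
last-[] []      ()
last-[] (_ ∷ _) ()

last-a : ∀ a → LastIsNot (suc a) (a ∷ [])
last-a a []          e = a≢1+a a (Listₚ.∷-injectiveˡ e)
last-a a (_ ∷ [])    ()
last-a a (_ ∷ _ ∷ _) ()

last-ba : ∀ a → LastIsNot (suc a) (suc a ∷ a ∷ [])
last-ba a []              ()
last-ba a (_ ∷ [])        e = a≢1+a a (Listₚ.∷-injectiveˡ (Listₚ.∷-injectiveʳ e))
last-ba a (_ ∷ _ ∷ [])    ()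
last-ba a (_ ∷ _ ∷ _ ∷ _) ()

only-[] : ∀ {a b} → OnlyInBA a b []
only-[] []      _ ()
only-[] (_ ∷ _) _ ()

only-b : ∀ a → OnlyInBA a (suc a) (suc a ∷ [])
only-b a []          Q e = ⊥-elim (a≢1+a a (Listₚ.∷-injectiveˡ e))
only-b a (_ ∷ [])    Q ()
only-b a (_ ∷ _ ∷ _) Q ()

only-ba : ∀ a → OnlyInBA a (suc a) (suc a ∷ a ∷ [])
only-ba a []              Q e = ⊥-elim (a≢1+a a (Listₚ.∷-injectiveˡ e))
only-ba a (p ∷ [])        Q e = cong (_∷ []) (Listₚ.∷-injectiveˡ e) , Listₚ.∷-injectiveʳ (Listₚ.∷-injectiveʳ e)
only-ba a (_ ∷ _ ∷ [])    Q ()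
only-ba a (_ ∷ _ ∷ _ ∷ _) Q ()

σ-Doubled : ∀ {μ} j {w w′} → Doubled μ (suc (suc j)) w → σ (suc j) w ≡ just w′ → Doubled μ (suc j) w′
σ-Doubled {μ} j {w} d eq with σ-≡just (suc j) w eq
... | bs′ , v , refl = by-view v (sym (decode-encode a (All-sub (inAB a) w)))
  where
  a = suc j
  b = suc a
  open Doubled d
  one-a : count a (sub (inAB a) w) ≡ 1
  one-a = trans (count-sub (inAB a) w (inAB-a a)) (once (s≤s z≤n) (ℕₚ.n<1+n a))
  not-two-a : ∀ xs ys zs → sub (inAB a) w ≢ xs ++ a ∷ ys ++ a ∷ zs
  not-two-a xs ys zs s = ℕₚ.<-irrefl refl (ℕₚ.≤-trans (count-two a xs ys zs) (ℕₚ.≤-reflexive (trans (cong (count a) (sym s)) one-a)))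
  by-view : ∀ {bs bs′} → ExchView bs bs′ → sub (inAB a) w ≡ decode a bs → Doubled μ a (replaceSub (inAB a) w (decode a bs′))
  by-view abb→aab s = lower-letter w (a ∷ [])     (b ∷ [])     (s≤s z≤n) d s (last-a a)  (only-b a)
  by-view bab→baa s = lower-letter w (b ∷ a ∷ []) []           (s≤s z≤n) d s (last-ba a) only-[]
  by-view bba→aba s = lower-letter w []           (b ∷ a ∷ []) (s≤s z≤n) d s last-[]    (only-ba a)
  by-view aab→abb s = ⊥-elim (not-two-a [] [] (b ∷ []) s)
  by-view aba→bba s = ⊥-elim (not-two-a [] (b ∷ []) [] s)
  by-view baa→bab s = ⊥-elim (not-two-a (b ∷ []) [] [] s)

σDown-Doubled : ∀ {μ} k {w w₁} → Doubled μ (suc k) w → σDown k w ≡ just w₁ → Doubled μ 1 w₁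
σDown-Doubled zero    d refl = d
σDown-Doubled (suc k) {w} d eq with >>=-≡just (σ (suc k) w) (σDown k) eq
... | w′ , e₁ , e₂ = σDown-Doubled k (σ-Doubled k d e₁) e₂

sum-applyUpTo-+ : ∀ (f g : ℕ → ℕ) L → sum (applyUpTo (λ i → f i + g i) L) ≡ sum (applyUpTo f L) + sum (applyUpTo g L)
sum-applyUpTo-+ f g zero    = refl
sum-applyUpTo-+ f g (suc L) =
  trans (cong (f 0 + g 0 +_) (sum-applyUpTo-+ (f ∘ suc) (g ∘ suc) L)) (interchange (f 0) (g 0) _ _)

sum-applyUpTo-part : ∀ λ′ {L} → length λ′ ≤ L → sum (applyUpTo (part λ′) L) ≡ sum λ′
sum-applyUpTo-part []       {zero}  _         = refl
sum-applyUpTo-part []       {suc L} _         = sum-applyUpTo-part [] {L} z≤n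
sum-applyUpTo-part (x ∷ λ′) {suc L} (s≤s le) = cong (x +_) (sum-applyUpTo-part λ′ le)

module _ (T : Tableau) (fills : Fills T) (pos : All (0 <_) (shape T)) (μ : List ℕ) (T⊑μ : shape T ⊑ μ) (c : ℕ) where

  private
    X = rows T
    L = length μ
    added : ℕ → ℕ
    added i = part μ i ∸ part (shape T) i
    new : ℕ → ℕ
    new x = sum (applyUpTo (λ i → count x (replicate (added i) c)) L)

  count-addStrip : ∀ x → count x (word (addStrip T μ c)) ≡ count x (word T) + new x
  count-addStrip x = begin
    count x (concat (reverse rs))
      ≡⟨ count-↭ x (concat-reverse-↭ rs) ⟩
    count x (concat rs)
      ≡⟨ count-concat x rs ⟩
    sum (map (count x) rs)
      ≡⟨ cong sum (Listₚ.map-applyUpTo (stripRow T μ c) (count x) L) ⟩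
    sum (applyUpTo (λ i → count x (stripRow T μ c i)) L)
      ≡⟨ cong sum (applyUpTo-cong L (λ i → count-++ x (rowAt X i) (replicate (added i) c))) ⟩
    sum (applyUpTo (λ i → count x (rowAt X i) + count x (replicate (added i) c)) L)
      ≡⟨ sum-applyUpTo-+ (count x ∘ rowAt X) (λ i → count x (replicate (added i) c)) L ⟩
    sum (applyUpTo (count x ∘ rowAt X) L) + new x
      ≡⟨ cong (_+ new x) old-rows ⟩
    count x (word T) + new x ∎
    where
    open ≡-Reasoning
    rs = applyUpTo (stripRow T μ c) L
    old-rows : sum (applyUpTo (count x ∘ rowAt X) L) ≡ count x (word T)
    old-rows = begin
      sum (applyUpTo (count x ∘ rowAt X) L)               ≡⟨ cong sum (Listₚ.map-applyUpTo (rowAt X) (count x) L) ⟨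
      sum (map (count x) (applyUpTo (rowAt X) L))         ≡⟨ cong (sum ∘ map (count x)) (applyUpTo-rowAt X (length-rows-≤ T μ fills pos T⊑μ)) ⟩
      sum (map (count x) (X ++ replicate (L ∸ length X) [])) ≡⟨ count-concat x (X ++ replicate (L ∸ length X) []) ⟨
      count x (concat (X ++ replicate (L ∸ length X) [])) ≡⟨ cong (count x) (Listₚ.concat-++ X (replicate (L ∸ length X) [])) ⟨
      count x (concat X ++ concat (replicate (L ∸ length X) [])) ≡⟨ cong (λ z → count x (concat X ++ z)) (concat-empty (L ∸ length X)) ⟩
      count x (concat X ++ [])                            ≡⟨ cong (count x) (Listₚ.++-identityʳ (concat X)) ⟩
      count x (concat X)                                  ≡⟨ count-↭ x (concat-reverse-↭ X) ⟨
      count x (concat (reverse X))                        ≡⟨ cong (count x) (word-rows T fills) ⟩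
      count x (word T)                                    ∎
      where
      concat-empty : ∀ k → concat {A = ℕ} (replicate k []) ≡ []
      concat-empty zero    = refl
      concat-empty (suc k) = concat-empty k

  count-addStrip-old : ∀ {x} → c ≢ x → count x (word (addStrip T μ c)) ≡ count x (word T)
  count-addStrip-old {x} c≢x = trans (count-addStrip x)
    (trans (cong (count x (word T) +_) none) (ℕₚ.+-identityʳ _))
    where
    none : new x ≡ 0
    none = trans (cong sum (applyUpTo-cong L (λ i → count-none (Allₚ.replicate⁺ (added i) c≢x)))) (zeros L)
      where
      zeros : ∀ L → sum (applyUpTo (λ _ → 0) L) ≡ 0
      zeros zero    = refl
      zeros (suc L) = zeros L

  count-addStrip-new : count c (word T) ≡ 0 → sum μ ≡ sum (shape T) + 2 → count c (word (addStrip T μ c)) ≡ 2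
  count-addStrip-new absent sumμ = trans (count-addStrip c) (cong₂ _+_ absent (trans (cong sum (applyUpTo-cong L (λ i → count-replicate c (added i)))) two-added))
    where
    two-added : sum (applyUpTo added L) ≡ 2
    two-added = ℕₚ.+-cancelˡ-≡ (sum (shape T)) (sum (applyUpTo added L)) 2 (begin
      sum (shape T) + sum (applyUpTo added L)                       ≡⟨ cong (_+ sum (applyUpTo added L)) (sum-applyUpTo-part (shape T) (length-mono-⊑ μ pos T⊑μ)) ⟨
      sum (applyUpTo (part (shape T)) L) + sum (applyUpTo added L)  ≡⟨ sum-applyUpTo-+ (part (shape T)) added L ⟨
      sum (applyUpTo (λ i → part (shape T) i + added i) L)          ≡⟨ cong sum (applyUpTo-cong L (λ i → ℕₚ.m+[n∸m]≡n (T⊑μ i))) ⟩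
      sum (applyUpTo (part μ) L)                                    ≡⟨ cong sum (applyUpTo-part μ) ⟩
      sum μ                                                         ≡⟨ sumμ ⟩
      sum (shape T) + 2                                             ∎)
      where open ≡-Reasoning

Sorted-++-replicate : ∀ {r} c k → Sorted r → All (_≤ c) r → Sorted (r ++ replicate k c)
Sorted-++-replicate c zero          s             _          = subst Sorted (sym (Listₚ.++-identityʳ _)) s
Sorted-++-replicate c (suc zero)    []            []         = [-]
Sorted-++-replicate c (suc (suc k)) []            []         = ℕₚ.≤-refl ∷ Sorted-++-replicate c (suc k) [] []
Sorted-++-replicate c (suc k)       [-]           (x≤c ∷ []) = x≤c ∷ Sorted-++-replicate c (suc k) [] []
Sorted-++-replicate c (suc k)       (x≤y ∷ s)     (_ ∷ les)  = x≤y ∷ Sorted-++-replicate c (suc k) s les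

ColStrict-++-replicate : ∀ (P Q : Word) {k c} Z → ColStrict P Q → length Q + k ≤ length P → All (_< c) P →
                         ColStrict (P ++ Z) (Q ++ replicate k c)
ColStrict-++-replicate P       []      {zero}  Z _        _         _          = ColStrict-[] (P ++ Z)
ColStrict-++-replicate (_ ∷ P) []      {suc k} Z _        (s≤s le) (p<c ∷ ps) = p<c ∷ ColStrict-++-replicate P [] Z (ColStrict-[] P) le ps
ColStrict-++-replicate (_ ∷ P) (_ ∷ Q)         Z (lt ∷ c) (s≤s le) (_ ∷ ps)   = lt ∷ ColStrict-++-replicate P Q Z c le ps

A-term-Doubled : ∀ T ν → IsStandard T → HStrip2 (shape T) ν → Doubled (shape (A-term T ν)) (suc (degree T)) (word (A-term T ν))
A-term-Doubled T ν std@((((_ , pos) , fills) , sorted , columns) , _) (partition , T⊑ν , ν⊑T , sumν) = record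
  { fills     = fromRows-fills rs
  ; partition = subst IsPartition (sym (shape-stripRows T fills ν T⊑ν c)) partition
  ; sorted    = subst (All Sorted) (sym (rows-fromRows rs)) (Allₚ.applyUpTo⁺₂ (stripRow T ν c) (length ν) sorted-row)
  ; columns   = subst (Linked ColStrict) (sym (rows-fromRows rs)) (Linkedₚ.applyUpTo⁺₂ (stripRow T ν c) (length ν) strict-column)
  ; twice     = count-addStrip-new T fills pos ν T⊑ν c (count-none (All.map (λ (_ , x≤n) → ℕₚ.<⇒≢ (s≤s x≤n)) range)) sumν
  ; once      = λ 1≤x x<c → trans (count-addStrip-old T fills pos ν T⊑ν c (ℕₚ.>⇒≢ x<c)) (standard-count T std 1≤x (ℕₚ.≤-pred x<c))
  ; positive  = All-addStrip T ν c (All.map proj₁ range) (s≤s z≤n)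
  }
  where
  n = degree T
  c = suc n
  X = rows T
  rs = applyUpTo (stripRow T ν c) (length ν)
  range : InRange n (word T)
  range = standard-InRange T std
  row-bounded : ∀ i → All (_≤ n) (rowAt X i)
  row-bounded i = All-rowAt i (All-rows T (All.map proj₂ range)) []
  length-row : ∀ i → length (rowAt X i) ≡ part (shape T) i
  length-row i = trans (length-rowAt X i) (cong (λ s → part s i) (shape-rows T fills))
  sorted-row : ∀ i → Sorted (stripRow T ν c i)
  sorted-row i = Sorted-++-replicate c _ (All-rowAt i sorted []) (All.map ℕₚ.m≤n⇒m≤1+n (row-bounded i))
  strict-column : ∀ i → ColStrict (stripRow T ν c i) (stripRow T ν c (suc i))
  strict-column i = ColStrict-++-replicate (rowAt X i) (rowAt X (suc i)) _
    (Linked-rowAt⇒ (zip⇒Linked X columns) ColStrict-[] i)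
    (subst₂ _≤_ (sym (trans (cong (_+ (part ν (suc i) ∸ part (shape T) (suc i))) (length-row (suc i))) (ℕₚ.m+[n∸m]≡n (T⊑ν (suc i))))) (sym (length-row i)) (ν⊑T i))
    (All.map s≤s (row-bounded i))

-- The reading word of (B₂⁽⁰⁾ T)ᵗ

ColStrict-bounded : ∀ {k} (z z′ : Word) → ColStrict z z′ → length z′ ≤ length z → All (k ≤_) z → All (suc k ≤_) z′
ColStrict-bounded z       []       _        _         _          = []
ColStrict-bounded (x ∷ z) (y ∷ z′) (lt ∷ c) (s≤s le) (k≤x ∷ ks) = ℕₚ.≤-<-trans k≤x lt ∷ ColStrict-bounded z z′ c le ks

rows-above-bounded : ∀ {k} z Zs → Linked ColStrict (z ∷ Zs) → Decreasing (z ∷ Zs) → All (k ≤_) z → All (All (suc k ≤_)) Zs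
rows-above-bounded z []        _       _        _  = []
rows-above-bounded z (z′ ∷ Zs) (c ∷ l) (le ∷ d) ks =
  ks′ ∷ All.map (All.map (ℕₚ.≤-trans (ℕₚ.n≤1+n _))) (rows-above-bounded z′ Zs l d ks′)
  where ks′ = ColStrict-bounded z z′ c le ks

count-1-≥2 : ∀ {w} → All (2 ≤_) w → count 1 w ≡ 0
count-1-≥2 ps = count-none (All.map (λ { (s≤s (s≤s _)) () }) ps)

bottom-row-11 : ∀ {z} → Sorted z → Positive z → count 1 z ≡ 2 → ∃ λ r → z ≡ 1 ∷ 1 ∷ r × All (2 ≤_) r
bottom-row-11 {suc zero ∷ suc zero ∷ r}    _           (_ ∷ _ ∷ ps) ones = r , refl , no-more-1 ps (ℕₚ.suc-injective (ℕₚ.suc-injective ones))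
  where
  no-more-1 : ∀ {w} → Positive w → count 1 w ≡ 0 → All (2 ≤_) w
  no-more-1 {[]}              []      _  = []
  no-more-1 {suc (suc _) ∷ _} (_ ∷ ps) e = s≤s (s≤s z≤n) ∷ no-more-1 ps e
bottom-row-11 {suc zero ∷ suc (suc y) ∷ r} (_ ∷ s)     _            ones
  with () ← trans (sym (count-1-≥2 {suc (suc y) ∷ r} (s≤s (s≤s z≤n) ∷ All.map (ℕₚ.≤-trans (s≤s (s≤s z≤n))) (Sorted-∷⇒All s))))
                  (ℕₚ.suc-injective ones)
bottom-row-11 {suc (suc y) ∷ r}            s           _            ones
  with () ← trans (sym (count-1-≥2 {suc (suc y) ∷ r} (s≤s (s≤s z≤n) ∷ All.map (ℕₚ.≤-trans (s≤s (s≤s z≤n))) (Sorted-∷⇒All s)))) ones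
bottom-row-11 {[]}                         _           _            ()
bottom-row-11 {suc zero ∷ []}              _           _            ()
bottom-row-11 {zero ∷ _}                   _           (() ∷ _)     _
bottom-row-11 {suc zero ∷ zero ∷ _}        _           (_ ∷ () ∷ _) _

Doubled-1-rows : ∀ {μ w₁} → Doubled μ 1 w₁ →
                 ∃ λ r → ∃ λ Zs → rows (tab μ w₁) ≡ (1 ∷ 1 ∷ r) ∷ Zs × All (2 ≤_) r × All (All (2 ≤_)) Zs
Doubled-1-rows {μ} {w₁} d = from (rows (tab μ w₁)) refl
  where
  open Doubled d
  word≡ : ∀ {Z} → rows (tab μ w₁) ≡ Z → w₁ ≡ concat (reverse Z)
  word≡ eq = trans (sym (word-rows (tab μ w₁) fills)) (cong (concat ∘ reverse) eq)
  from : ∀ Z → rows (tab μ w₁) ≡ Z →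
         ∃ λ r → ∃ λ Zs → rows (tab μ w₁) ≡ (1 ∷ 1 ∷ r) ∷ Zs × All (2 ≤_) r × All (All (2 ≤_)) Zs
  from []         eq with () ← trans (sym (cong (count 1) (word≡ eq))) twice
  from (z₀ ∷ Zs) eq = bottom-row (bottom-row-11 (All.head sorted-rows) (All.head positive-rows) ones-bottom)
    where
    sorted-rows : All Sorted (z₀ ∷ Zs)
    sorted-rows = subst (All Sorted) eq sorted
    positive-rows : All (All (1 ≤_)) (z₀ ∷ Zs)
    positive-rows = subst (All (All (1 ≤_))) eq (All-rows (tab μ w₁) positive)
    above : All (All (2 ≤_)) Zs
    above = rows-above-bounded z₀ Zs (subst (Linked ColStrict) eq columns)
              (subst (Linked _≥_) (sym (trans (cong (map length) (sym eq)) (shape-rows (tab μ w₁) fills))) (proj₁ partition))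
              (All.head positive-rows)
    ones-bottom : count 1 z₀ ≡ 2
    ones-bottom = begin
      count 1 z₀                                   ≡⟨ cong (_+ count 1 z₀) (count-1-≥2 (Allₚ.concat⁺ (All-reverse above))) ⟨
      count 1 (concat (reverse Zs)) + count 1 z₀   ≡⟨ count-++ 1 (concat (reverse Zs)) z₀ ⟨
      count 1 (concat (reverse Zs) ++ z₀)          ≡⟨ cong (count 1) (trans (word≡ eq) (concat-reverse-∷ z₀ Zs)) ⟨
      count 1 w₁                                   ≡⟨ twice ⟩
      2                                            ∎
      where open ≡-Reasoning
    bottom-row : (∃ λ r → z₀ ≡ 1 ∷ 1 ∷ r × All (2 ≤_) r) →
                 ∃ λ r → ∃ λ Zs′ → rows (tab μ w₁) ≡ (1 ∷ 1 ∷ r) ∷ Zs′ × All (2 ≤_) r × All (All (2 ≤_)) Zs′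
    bottom-row (r , z₀≡ , r≥2) = r , Zs , trans eq (cong (_∷ Zs) z₀≡) , r≥2 , above

replaceFirst-skip : ∀ {P} Q → All (2 ≤_) P → replaceFirst 1 0 (P ++ Q) ≡ P ++ replaceFirst 1 0 Q
replaceFirst-skip Q []                     = refl
replaceFirst-skip Q (s≤s (s≤s _) ∷ ps) = cong (_ ∷_) (replaceFirst-skip Q ps)

rows-B0 : ∀ {μ w₁ r Zs} → Fills (tab μ w₁) → rows (tab μ w₁) ≡ (1 ∷ 1 ∷ r) ∷ Zs → All (All (2 ≤_)) Zs →
          rows (tab μ (τ₊₁ (replaceFirst 1 0 w₁))) ≡ (1 ∷ 2 ∷ τ₊₁ r) ∷ map τ₊₁ Zs
rows-B0 {μ} {w₁} {r} {Zs} fills eq above = rows-tab ((1 ∷ 2 ∷ τ₊₁ r) ∷ map τ₊₁ Zs) shape≡ (sym word≡)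
  where
  open ≡-Reasoning
  shape≡ : map length ((1 ∷ 2 ∷ τ₊₁ r) ∷ map τ₊₁ Zs) ≡ μ
  shape≡ = begin
    map length ((1 ∷ 2 ∷ τ₊₁ r) ∷ map τ₊₁ Zs)   ≡⟨ cong₂ (λ n ns → suc (suc n) ∷ ns) (Listₚ.length-map suc r)
                                                          (trans (sym (Listₚ.map-∘ Zs)) (Listₚ.map-cong (Listₚ.length-map suc) Zs)) ⟩
    map length ((1 ∷ 1 ∷ r) ∷ Zs)               ≡⟨ cong (map length) eq ⟨
    map length (rows (tab μ w₁))                 ≡⟨ shape-rows (tab μ w₁) fills ⟩
    μ                                            ∎
  P = concat (reverse Zs)
  word≡ : τ₊₁ (replaceFirst 1 0 w₁) ≡ concat (reverse ((1 ∷ 2 ∷ τ₊₁ r) ∷ map τ₊₁ Zs))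
  word≡ = begin
    τ₊₁ (replaceFirst 1 0 w₁)                     ≡⟨ cong (τ₊₁ ∘ replaceFirst 1 0) (trans (sym (word-rows (tab μ w₁) fills))
                                                                                       (trans (cong (concat ∘ reverse) eq) (concat-reverse-∷ _ Zs))) ⟩
    τ₊₁ (replaceFirst 1 0 (P ++ 1 ∷ 1 ∷ r))       ≡⟨ cong τ₊₁ (replaceFirst-skip (1 ∷ 1 ∷ r) (Allₚ.concat⁺ (All-reverse above))) ⟩
    τ₊₁ (P ++ 0 ∷ 1 ∷ r)                          ≡⟨ Listₚ.map-++ suc P (0 ∷ 1 ∷ r) ⟩
    τ₊₁ P ++ 1 ∷ 2 ∷ τ₊₁ r                        ≡⟨ cong (_++ 1 ∷ 2 ∷ τ₊₁ r) (Listₚ.concat-map (reverse Zs)) ⟨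
    concat (map τ₊₁ (reverse Zs)) ++ 1 ∷ 2 ∷ τ₊₁ r ≡⟨ cong (λ z → concat z ++ 1 ∷ 2 ∷ τ₊₁ r) (Listₚ.reverse-map τ₊₁ Zs) ⟩
    concat (reverse (map τ₊₁ Zs)) ++ 1 ∷ 2 ∷ τ₊₁ r ≡⟨ concat-reverse-∷ _ (map τ₊₁ Zs) ⟨
    concat (reverse ((1 ∷ 2 ∷ τ₊₁ r) ∷ map τ₊₁ Zs)) ∎

All-nth : ∀ {P : ℕ → Set} {r : Word} j {v} → All P r → nth j r ≡ just v → P v
All-nth zero    (p ∷ _)  refl = p
All-nth (suc j) (_ ∷ ps) e    = All-nth j ps e

All-column : ∀ {P : ℕ → Set} j {X : List Word} → All (λ r → ∀ {v} → nth j r ≡ just v → P v) X → All P (column j X)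
All-column j {[]}    []         = []
All-column j {r ∷ X} (pr ∷ ps) with nth j r
... | just v  = pr refl ∷ All-column j ps
... | nothing = All-column j ps

transpose-reading-21 : ∀ r Zs → All (3 ≤_) r → All (All (3 ≤_)) Zs →
                       sub is12 (concat (reverse (transposeRows ((1 ∷ 2 ∷ r) ∷ Zs)))) ≡ 2 ∷ 1 ∷ []
transpose-reading-21 r Zs r≥3 Zs≥3 = begin
  sub is12 (concat (reverse (C₀ ∷ C₁ ∷ Cs)))                   ≡⟨ cong (sub is12 ∘ concat) (reverse-++-∷ (C₀ ∷ []) C₁ Cs) ⟩
  sub is12 (concat (reverse Cs ++ C₁ ∷ C₀ ∷ []))               ≡⟨ cong (sub is12) (Listₚ.concat-++ (reverse Cs) (C₁ ∷ C₀ ∷ [])) ⟨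
  sub is12 (concat (reverse Cs) ++ C₁ ++ C₀ ++ [])             ≡⟨ sub-++ is12 (concat (reverse Cs)) (C₁ ++ C₀ ++ []) ⟩
  sub is12 (concat (reverse Cs)) ++ sub is12 (C₁ ++ C₀ ++ [])  ≡⟨ cong₂ _++_ (big (Allₚ.concat⁺ (All-reverse Cs≥3))) first-columns ⟩
  2 ∷ 1 ∷ []                                                   ∎
  where
  open ≡-Reasoning
  Z = (1 ∷ 2 ∷ r) ∷ Zs
  C₀ = column 0 Z
  C₁ = column 1 Z
  Cs = applyUpTo (λ j → column (suc (suc j)) Z) (length r)
  big : ∀ {w} → All (3 ≤_) w → sub is12 w ≡ []
  big ps = sub-none is12 (All.map (λ { (s≤s (s≤s (s≤s _))) → refl }) ps)
  entries : ∀ {j} {X : List Word} → All (All (3 ≤_)) X → All (λ r → ∀ {v} → nth j r ≡ just v → 3 ≤ v) X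
  entries {j} = All.map (λ ps {v} → All-nth j ps)
  Cs≥3 : All (All (3 ≤_)) Cs
  Cs≥3 = Allₚ.applyUpTo⁺₂ _ (length r) (λ j → All-column (suc (suc j)) {Z} ((λ {v} → All-nth j r≥3) ∷ entries Zs≥3))
  first-columns : sub is12 (C₁ ++ C₀ ++ []) ≡ 2 ∷ 1 ∷ []
  first-columns = begin
    sub is12 (C₁ ++ C₀ ++ [])                 ≡⟨ sub-++ is12 C₁ (C₀ ++ []) ⟩
    sub is12 C₁ ++ sub is12 (C₀ ++ [])        ≡⟨ cong (sub is12 C₁ ++_) (cong (sub is12) (Listₚ.++-identityʳ C₀)) ⟩
    sub is12 C₁ ++ sub is12 C₀                ≡⟨ cong₂ (λ l r → (2 ∷ l) ++ 1 ∷ r) (big (All-column 1 (entries Zs≥3)))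
                                                                           (big (All-column 0 (entries Zs≥3))) ⟩
    2 ∷ 1 ∷ []                                ∎

module _ {T T′ : Tableau} (std : IsStandard T) (occ : OccursB0 T T′) where

  open B0Occurrence (OccursB0⇒B0Occurrence {T} occ)

  private
    doubled : Doubled (shape (A-term T μ)) 1 w₁
    doubled = σDown-Doubled (degree T) (A-term-Doubled T μ std strip) sorting

  B0-wellFormed : WellFormed T′
  B0-wellFormed = subst WellFormed (sym result)
    ( Doubled.partition doubled
    , trans (Listₚ.length-map suc (replaceFirst 1 0 w₁)) (trans (length-replaceFirst 1 0 w₁) (Doubled.fills doubled)))

  B0-transpose-reading : sub is12 (word (transpose T′)) ≡ 2 ∷ 1 ∷ []
  B0-transpose-reading with r , Zs , rows≡ , r≥2 , Zs≥2 ← Doubled-1-rows doubled =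
    subst (λ t → sub is12 (word (transpose t)) ≡ 2 ∷ 1 ∷ []) (sym result) $
    trans (cong (sub is12 ∘ concat ∘ reverse ∘ transposeRows) (rows-B0 {shape (A-term T μ)} {w₁} (Doubled.fills doubled) rows≡ Zs≥2))
          (transpose-reading-21 (τ₊₁ r) (map τ₊₁ Zs) (Allₚ.map⁺ (All.map s≤s r≥2))
                                (Allₚ.map⁺ (All.map (λ ps → Allₚ.map⁺ (All.map s≤s ps)) Zs≥2)))

B0*-B0-standard : (T₁ T₁′ : Tableau) → IsStandard T₁ → OccursB0 T₁ T₁′ → B0* T₁′ ≡ just T₁
B0*-B0-standard T _ std = B0*-B0 (proj₁ (proj₁ std)) (standard-InRange T std)

B1*-B1-standard : (T₂ T₂′ : Tableau) → IsStandard T₂ → OccursB1 T₂ T₂′ → B1* T₂′ ≡ just T₂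
B1*-B1-standard T _ std (S , occ , refl) = begin
  B1* (transpose S)                                       ≡⟨ B1*-unfold (transpose S) (B0-transpose-reading stdᵗ occ) ⟩
  (B0* (transpose (transpose S)) >>= just ∘ transpose)    ≡⟨ cong (λ t → B0* t >>= just ∘ transpose) (transpose-involutive (B0-wellFormed stdᵗ occ)) ⟩
  (B0* S >>= just ∘ transpose)                            ≡⟨ cong (_>>= just ∘ transpose) (B0*-B0-standard (transpose T) S stdᵗ occ) ⟩
  just (transpose (transpose T))                          ≡⟨ cong just (transpose-involutive (proj₁ (proj₁ std))) ⟩
  just T                                                  ∎
  where
  open ≡-Reasoning
  stdᵗ : IsStandard (transpose T)
  stdᵗ = transpose-standard T std

mainTheorem15 : ((T₁ T₁′ : Tableau) → IsStandard T₁ → OccursB0 T₁ T₁′ → B0* T₁′ ≡ just T₁)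
    × ((T₂ T₂′ : Tableau) → IsStandard T₂ → OccursB1 T₂ T₂′ → B1* T₂′ ≡ just T₂)
mainTheorem15 = B0*-B0-standard , B1*-B1-standard
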